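{- Let $G$ be a connected maximal nontraceable graph of order $n\ge 7$ which has no vertex of degree $1$ and no two adjacent vertices both of degree $2$. If $G$ has exactly $m$ vertices of degree $2$, then $e(G)\ge \tfrac12(3n+m)$.
   Context: Graphs are simple and finite; $e(G)$ is the number of edges. A graph is traceable if it has a hamiltonian path. A graph $G$ is maximal nontraceable if $G$ is not traceable but $G+e$ is traceable for every pair of nonadjacent vertices joined by a new edge $e$. -}

module Defs where

open import Data.Nat using (ℕ; zero; suc; _+_; _<ᵇ_)
open import Data.Bool using (Bool; true; false; _∧_; if_then_else_)
open import Data.Fin using (Fin; toℕ; inject₁; fromℕ)
  renaming (zero to fzero; suc to fsuc)
open import Data.Fin.Properties using (_≟_)
open import Data.List using (List; []; _∷_)
open import Data.Product using (Σ; ∃; _×_; _,_)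
open import Relation.Binary.PropositionalEquality using (_≡_; _≢_)
open import Relation.Nullary using (yes; no)
open import Relation.Nullary using (¬_; does)
open import Function.Definitions using (Injective)
open import Data.Unit using (⊤)
open import Data.Empty using (⊥; ⊥-elim)
open import Data.Bool using (_∨_)
open import Data.Bool.Properties using (∨-comm; ∧-comm)
open import Relation.Binary.PropositionalEquality using (cong₂)
open import Data.Sum using (_⊎_)
open import Relation.Binary.PropositionalEquality using (refl; trans; sym)

record Graph (n : ℕ) : Set where
  field
    adj    : Fin n → Fin n → Bool
    adj-sym : ∀ u v → adj u v ≡ adj v u
    irrefl : ∀ v → adj v v ≡ false
open Graph public

Adjacent : ∀ {n} → Graph n → Fin n → Fin n → Set
Adjacent G u v = adj G u v ≡ true

count : ∀ {n} → (Fin n → Bool) → ℕ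
count {zero}  P = 0
count {suc n} P = (if P fzero then 1 else 0) + count (λ i → P (fsuc i))

sumFin : ∀ {n} → (Fin n → ℕ) → ℕ
sumFin {zero}  f = 0
sumFin {suc n} f = f fzero + sumFin (λ i → f (fsuc i))

degree : ∀ {n} → Graph n → Fin n → ℕ
degree G v = count (adj G v)

edges : ∀ {n} → Graph n → ℕ
edges G = sumFin (λ u → count (λ v → (toℕ u <ᵇ toℕ v) ∧ adj G u v))

-- Hamiltonian path (n ≥ 1): an injective (hence bijective) listing
-- p : Fin (suc k) → Fin (suc k) of all vertices with consecutive entries adjacent.
Traceable : ∀ {n} → Graph n → Set
Traceable {zero}  G = ⊤
Traceable {suc k} G =
  Σ (Fin (suc k) → Fin (suc k)) λ p →
    Injective _≡_ _≡_ p ×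
    (∀ (i : Fin k) → Adjacent G (p (inject₁ i)) (p (fsuc i)))

isPair : ∀ {n} → Fin n → Fin n → Fin n → Fin n → Bool
isPair u v x y = (does (x ≟ u) ∧ does (y ≟ v)) ∨ (does (x ≟ v) ∧ does (y ≟ u))

addEdgeAdj : ∀ {n} → Graph n → Fin n → Fin n → Fin n → Fin n → Bool
addEdgeAdj G u v x y = isPair u v x y ∨ adj G x y

addEdge-sym : ∀ {n} (G : Graph n) u v x y → addEdgeAdj G u v x y ≡ addEdgeAdj G u v y x
addEdge-sym G u v x y =
  cong₂ _∨_
    (trans (∨-comm (does (x ≟ u) ∧ does (y ≟ v)) _)
           (cong₂ _∨_ (∧-comm (does (x ≟ v)) _) (∧-comm (does (x ≟ u)) _)))
    (adj-sym G x y)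

addEdge : ∀ {n} (G : Graph n) (u v : Fin n) → u ≢ v → Graph n
addEdge G u v u≢v = record
  { adj = addEdgeAdj G u v
  ; adj-sym = addEdge-sym G u v
  ; irrefl = irr }
  where
  irr : ∀ x → addEdgeAdj G u v x x ≡ false
  irr x with x ≟ u | x ≟ v
  ... | yes refl | yes refl = ⊥-elim (u≢v refl)
  ... | yes refl | no _ = irrefl G x
  ... | no _ | yes _ = irrefl G x
  ... | no _ | no _ = irrefl G x

MaximalNontraceable : ∀ {n} → Graph n → Set
MaximalNontraceable G =
  ¬ Traceable G ×
  (∀ u v → (u≢v : u ≢ v) → adj G u v ≡ false → Traceable (addEdge G u v u≢v))

data Walk {n} (G : Graph n) : Fin n → Fin n → Set where
  here : ∀ {v} → Walk G v v
  step : ∀ {u w v} → Adjacent G u w → Walk G w v → Walk G u v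

Connected : ∀ {n} → Graph n → Set
Connected G = ∀ u v → Walk G u v

{-# OPTIONS --safe #-}
module Submission where

-- Write d₂(x) and d₃(x) for the numbers of neighbours of x of degree 2 and of degree other
-- than 2. Double counting gives Σ d₂ = 2m and 2e(G) = Σ d₂ + Σ d₃, so it suffices that
-- d₃(x) ≥ 2 at the m vertices of degree 2 (no two of them are adjacent) and d₃(x) ≥ 3 at all
-- others. For the latter, maximality provides for every non-edge uv a Hamiltonian path of
-- G + uv through uv. Such paths force the two neighbours of a degree-2 vertex to be adjacent,
-- and put every degree-2 neighbour of x at an end of the segment before x in a Hamiltonian
-- path of G + xr. So if d₃(x) ≤ 2, either x has a non-neighbour and at most two neighbours of
-- degree 2, and each of the few resulting configurations can be rearranged into a Hamiltonian
-- path of G, or x is adjacent to everything and has at least four neighbours of degree 2;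
-- then three of them have the same two neighbours, which is impossible because a Hamiltonian
-- path of G + pq would have to separate these three vertices using only those two.

open import Defs
open import Data.Bool using (Bool; true; false; _∧_; _∨_; not; if_then_else_)
open import Data.Bool.Properties using (∧-comm; ∧-zeroʳ; ∧-identityʳ) renaming (_≟_ to _≟ᵇ_)
open import Data.Empty using (⊥; ⊥-elim)
open import Data.Fin using (Fin; toℕ; inject₁) renaming (zero to fzero; suc to fsuc)
open import Data.Fin.Properties using (_≟_; any?; toℕ-injective)
open import Data.List using (List; []; _∷_; _++_; [_]; length; reverse; tabulate; initLast; _∷ʳ′_)
open import Data.List.Properties
  using (++-assoc; unfold-reverse; reverse-++; length-tabulate; ∷-injectiveˡ; ∷-injectiveʳ; ∷ʳ-injectiveʳ)
open import Data.List.Membership.Propositional using (_∈_; _∉_)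
open import Data.List.Membership.Propositional.Properties using (∈-++⁺ˡ; ∈-++⁺ʳ; ∈-++⁻; ∈-∃++)
import Data.List.Membership.DecPropositional as DecMembership
import Data.List.Relation.Unary.All as All
open import Data.List.Relation.Unary.All using (All; []; _∷_)
open import Data.List.Relation.Unary.All.Properties using (¬Any⇒All¬)
open import Data.List.Relation.Unary.Any using (here; there)
open import Data.List.Relation.Unary.Any.Properties using (reverse⁺)
import Data.List.Relation.Unary.Linked as Linked
open import Data.List.Relation.Unary.Linked using (Linked; []; [-]; _∷_; head; tail)
open import Data.List.Relation.Unary.Unique.Propositional using (Unique; []; _∷_)
open import Data.List.Relation.Unary.Unique.Propositional.Properties using (Unique[x∷xs]⇒x∉xs; tabulate⁺)
open import Data.List.Relation.Binary.Permutation.Propositional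
  using (_↭_; ↭-refl; ↭-prep; ↭-swap; ↭-trans; ↭-sym; ↭⇒↭ₛ)
open import Data.List.Relation.Binary.Permutation.Propositional.Properties
  using (↭-length; ↭-reverse; ++⁺ˡ; shift; shifts)
import Data.List.Relation.Binary.Permutation.Setoid.Properties as PermutationSetoid
open import Data.Nat using (ℕ; zero; suc; _+_; _*_; _≤_; _≥_; _<_; z≤n; s≤s; _<ᵇ_; _≡ᵇ_; _≤?_)
  renaming (_≟_ to _≟ℕ_)
open import Data.Nat.Properties
  using (≤-refl; ≤-trans; ≤-reflexive; ≤-antisym; ≤-pred; ≤⇒≯; ≰⇒>; n≤1+n; m≤m+n; m≤n+m;
         +-mono-≤; +-monoʳ-≤; +-monoˡ-≤; +-cancelʳ-≤; +-comm; +-assoc; +-suc; +-identityʳ; *-comm; *-zeroʳ;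
         suc-injective; +-commutativeSemigroup; module ≤-Reasoning)
open import Algebra.Properties.CommutativeSemigroup +-commutativeSemigroup using (interchange)
open import Data.Product using (∃; ∃₂; _×_; _,_; proj₁; proj₂)
open import Data.Sum using (_⊎_; inj₁; inj₂; reduce) renaming (swap to ⊎-swap)
open import Function using (_∘_)
open import Relation.Binary.Definitions using (DecidableEquality; Symmetric)
open import Relation.Binary.PropositionalEquality
  using (_≡_; _≢_; refl; sym; trans; cong; cong₂; subst; subst₂; setoid; ≢-sym; module ≡-Reasoning)
open import Relation.Nullary using (¬_; Dec; yes; no; does; ¬?)
open import Relation.Nullary.Decidable using (True; toWitness; _×-dec_; dec-true; dec-false; decidable-stable)

χ : Bool → ℕ
χ b = if b then 1 else 0

χ≤1 : ∀ b → χ b ≤ 1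
χ≤1 true = ≤-refl
χ≤1 false = z≤n

cancel-≤ : ∀ {a b c d} → c + d ≤ a + b → b ≤ d → c ≤ a
cancel-≤ {a} {b} {c} {d} le b≤d = +-cancelʳ-≤ d c a (≤-trans le (+-monoʳ-≤ a b≤d))

does⇒ : ∀ {A : Set} (a? : Dec A) → does a? ≡ true → A
does⇒ (yes a) _ = a

clash : ∀ {b : Bool} → b ≡ true → b ≡ false → ⊥
clash refl ()

∧-does⇒ : ∀ {A : Set} {b : Bool} (a? : Dec A) → b ∧ does a? ≡ true → b ≡ true × A
∧-does⇒ {b = true} (yes a) _ = refl , a

∧-does⇐ : ∀ {A : Set} {b : Bool} (a? : Dec A) → b ≡ true → A → b ∧ does a? ≡ true
∧-does⇐ (yes _) refl _ = refl
∧-does⇐ (no ¬a) _ a = ⊥-elim (¬a a)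

∧-not-does⇒ : ∀ {A : Set} {b : Bool} (a? : Dec A) → b ∧ not (does a?) ≡ true → b ≡ true × (A → ⊥)
∧-not-does⇒ {b = true} (no ¬a) _ = refl , ¬a

∧-not-does⇐ : ∀ {A : Set} {b : Bool} (a? : Dec A) → b ≡ true → (A → ⊥) → b ∧ not (does a?) ≡ true
∧-not-does⇐ (yes a) _ ¬a = ⊥-elim (¬a a)
∧-not-does⇐ (no _) refl _ = refl

count-ext : ∀ {n} {P Q : Fin n → Bool} → (∀ i → P i ≡ Q i) → count P ≡ count Q
count-ext {zero} e = refl
count-ext {suc n} e = cong₂ _+_ (cong χ (e fzero)) (count-ext (λ i → e (fsuc i)))

count-false : ∀ {n} (P : Fin n → Bool) → (∀ i → P i ≡ false) → count P ≡ 0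
count-false {zero} P h = refl
count-false {suc n} P h rewrite h fzero = count-false (λ i → P (fsuc i)) (λ i → h (fsuc i))

count-true : ∀ {n} → count {n} (λ _ → true) ≡ n
count-true {zero} = refl
count-true {suc n} = cong suc count-true

count-split : ∀ {n} (P Q : Fin n → Bool) →
              count P ≡ count (λ i → P i ∧ Q i) + count (λ i → P i ∧ not (Q i))
count-split {zero} P Q = refl
count-split {suc n} P Q with P fzero | Q fzero
... | true | true = cong suc (count-split (λ i → P (fsuc i)) (λ i → Q (fsuc i)))
... | true | false = trans (cong suc (count-split (λ i → P (fsuc i)) (λ i → Q (fsuc i))))
                          (sym (+-suc _ _))
... | false | _ = count-split (λ i → P (fsuc i)) (λ i → Q (fsuc i))

count-at : ∀ {n} (P : Fin n → Bool) (a : Fin n) → count (λ i → P i ∧ does (i ≟ a)) ≡ χ (P a)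
count-at {suc n} P fzero with P fzero
... | true = cong suc (count-false _ (λ i → ∧-zeroʳ (P (fsuc i))))
... | false = count-false _ (λ i → ∧-zeroʳ (P (fsuc i)))
count-at {suc n} P (fsuc a) with P fzero
... | true = count-at (λ i → P (fsuc i)) a
... | false = count-at (λ i → P (fsuc i)) a

count-remove : ∀ {n} (P : Fin n → Bool) (a : Fin n) → P a ≡ true →
               count P ≡ suc (count (λ i → P i ∧ not (does (i ≟ a))))
count-remove P a pa = trans (count-split P (λ i → does (i ≟ a)))
  (cong (_+ count (λ i → P i ∧ not (does (i ≟ a)))) (trans (count-at P a) (cong χ pa)))

count≤length : ∀ {n} (P : Fin n → Bool) (L : List (Fin n)) →
               (∀ i → P i ≡ true → i ∈ L) → count P ≤ length L
count≤length P [] P⊆L = ≤-reflexive (count-false P absent)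
  where
  absent : ∀ i → P i ≡ false
  absent i with P i in eq
  ... | true with () ← P⊆L i eq
  ... | false = refl
count≤length P (a ∷ L) P⊆L = begin
  count P                                                       ≡⟨ count-split P (λ i → does (i ≟ a)) ⟩
  count (λ i → P i ∧ does (i ≟ a)) + count (λ i → P i ∧ not (does (i ≟ a)))
                                                                ≡⟨ cong (_+ count (λ i → P i ∧ not (does (i ≟ a)))) (count-at P a) ⟩
  χ (P a) + count (λ i → P i ∧ not (does (i ≟ a)))              ≤⟨ +-mono-≤ (χ≤1 (P a)) (count≤length _ L rest⊆L) ⟩
  suc (length L)                                                ∎
  where
  open ≤-Reasoning
  rest⊆L : ∀ i → P i ∧ not (does (i ≟ a)) ≡ true → i ∈ L
  rest⊆L i e with ∧-not-does⇒ (i ≟ a) e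
  ... | Pi , i≢a with P⊆L i Pi
  ...   | here i≡a = ⊥-elim (i≢a i≡a)
  ...   | there i∈L = i∈L

length≤count : ∀ {n} (P : Fin n → Bool) {L : List (Fin n)} →
               Unique L → All (λ i → P i ≡ true) L → length L ≤ count P
length≤count P [] [] = z≤n
length≤count P {a ∷ L} (a∉L ∷ uniq) (Pa ∷ PL) =
  subst (suc (length L) ≤_) (sym (count-remove P a Pa))
        (s≤s (length≤count _ uniq (All.zipWith (λ (Pi , a≢i) → ∧-not-does⇐ (_ ≟ a) Pi (a≢i ∘ sym)) (PL , a∉L))))

-- Kept opaque: these are only used through their types, and unfolding them inside later
-- with-abstractions is very expensive.
opaque
  count≤length⇒∈ : ∀ {n} (P : Fin n → Bool) {L : List (Fin n)} → Unique L → All (λ i → P i ≡ true) L →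
                   count P ≤ length L → ∀ {c} → P c ≡ true → c ∈ L
  count≤length⇒∈ P {L} uL PL P≤L {c} Pc =
    decidable-stable (DecMembership._∈?_ _≟_ c L)
      (λ c∉L → ≤⇒≯ P≤L (length≤count P (¬Any⇒All¬ L c∉L ∷ uL) (Pc ∷ PL)))

  fresh : ∀ {n} (P : Fin n → Bool) (L : List (Fin n)) → length L < count P →
          ∃ λ i → P i ≡ true × i ∉ L
  fresh P L L<P with any? (λ i → (P i ≟ᵇ true) ×-dec ¬? (DecMembership._∈?_ _≟_ i L))
  ... | yes found = found
  ... | no none = ⊥-elim (≤⇒≯ (count≤length P L P⊆L) L<P)
    where
    P⊆L : ∀ i → P i ≡ true → i ∈ L
    P⊆L i Pi = decidable-stable (DecMembership._∈?_ _≟_ i L) (λ i∉L → none (i , Pi , i∉L))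

  pick : ∀ {n} (P : Fin n → Bool) k → k ≤ count P →
         ∃ λ L → length L ≡ k × Unique L × All (λ i → P i ≡ true) L
  pick P zero _ = [] , refl , [] , []
  pick P (suc k) k<P with pick P k (≤-trans (n≤1+n k) k<P)
  ... | L , refl , uL , PL with fresh P L k<P
  ...   | c , Pc , c∉L = c ∷ L , refl , ¬Any⇒All¬ L c∉L ∷ uL , Pc ∷ PL

sumFin-ext : ∀ {n} {f g : Fin n → ℕ} → (∀ i → f i ≡ g i) → sumFin f ≡ sumFin g
sumFin-ext {zero} e = refl
sumFin-ext {suc n} e = cong₂ _+_ (e fzero) (sumFin-ext (λ i → e (fsuc i)))

sumFin-mono : ∀ {n} {f g : Fin n → ℕ} → (∀ i → f i ≤ g i) → sumFin f ≤ sumFin g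
sumFin-mono {zero} e = z≤n
sumFin-mono {suc n} e = +-mono-≤ (e fzero) (sumFin-mono (λ i → e (fsuc i)))

sumFin-+ : ∀ {n} (f g : Fin n → ℕ) → sumFin (λ i → f i + g i) ≡ sumFin f + sumFin g
sumFin-+ {zero} f g = refl
sumFin-+ {suc n} f g = trans (cong (f fzero + g fzero +_) (sumFin-+ (λ i → f (fsuc i)) (λ i → g (fsuc i))))
                             (interchange (f fzero) (g fzero) _ _)

sumFin-const : ∀ n c → sumFin {n} (λ _ → c) ≡ n * c
sumFin-const zero c = refl
sumFin-const (suc n) c = cong (c +_) (sumFin-const n c)

count-as-sum : ∀ {n} (P : Fin n → Bool) → count P ≡ sumFin (λ i → χ (P i))
count-as-sum {zero} P = refl
count-as-sum {suc n} P = cong (χ (P fzero) +_) (count-as-sum (λ i → P (fsuc i)))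

sumFin-swap : ∀ {n m} (f : Fin n → Fin m → ℕ) →
              sumFin (λ i → sumFin (f i)) ≡ sumFin (λ j → sumFin (λ i → f i j))
sumFin-swap {zero} {m} f = sym (trans (sumFin-const m 0) (*-zeroʳ m))
sumFin-swap {suc n} f = trans (cong (sumFin (f fzero) +_) (sumFin-swap (λ i → f (fsuc i))))
                              (sym (sumFin-+ (f fzero) (λ j → sumFin (λ i → f (fsuc i) j))))

count-swap : ∀ {n} (R : Fin n → Fin n → Bool) →
             sumFin (λ i → count (R i)) ≡ sumFin (λ j → count (λ i → R i j))
count-swap R = trans (sumFin-ext (λ i → count-as-sum (R i)))
  (trans (sumFin-swap (λ i j → χ (R i j))) (sym (sumFin-ext (λ j → count-as-sum (λ i → R i j)))))

module _ {A : Set} where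

  unique-tail : ∀ {x : A} {xs} → Unique (x ∷ xs) → Unique xs
  unique-tail (_ ∷ u) = u

  unique-++ʳ : ∀ xs {ys : List A} → Unique (xs ++ ys) → Unique ys
  unique-++ʳ [] u = u
  unique-++ʳ (x ∷ xs) (_ ∷ u) = unique-++ʳ xs u

  unique-++ˡ : ∀ xs {ys : List A} → Unique (xs ++ ys) → Unique xs
  unique-++ˡ [] u = []
  unique-++ˡ (x ∷ xs) {ys} (x∉ ∷ u) = prefix xs x∉ ∷ unique-++ˡ xs u
    where
    prefix : ∀ xs → All (x ≢_) (xs ++ ys) → All (x ≢_) xs
    prefix [] _ = []
    prefix (y ∷ xs) (x≢y ∷ all) = x≢y ∷ prefix xs all

  unique-disjoint : ∀ xs {ys} {c : A} → Unique (xs ++ ys) → c ∈ xs → c ∈ ys → ⊥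
  unique-disjoint (x ∷ xs) u (here refl) c∈ys = Unique[x∷xs]⇒x∉xs u (∈-++⁺ʳ xs c∈ys)
  unique-disjoint (x ∷ xs) (_ ∷ u) (there c∈xs) c∈ys = unique-disjoint xs u c∈xs c∈ys

  unique-resp-↭ : ∀ {xs ys : List A} → xs ↭ ys → Unique xs → Unique ys
  unique-resp-↭ p = PermutationSetoid.Unique-resp-↭ (setoid A) (↭⇒↭ₛ p)

  ∈-middle : ∀ xs {c : A} {ys} → c ∈ xs ++ c ∷ ys
  ∈-middle xs = ∈-++⁺ʳ xs (here refl)

  ∈-last : ∀ xs {c : A} ys → c ∈ (xs ++ [ c ]) ++ ys
  ∈-last xs ys = ∈-++⁺ˡ (∈-middle xs)

module _ {X : Set} where

  EndOfA : List X → X → X → Set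
  EndOfA A w h = A ≡ [ w ] ⊎ (∃ λ A′ → A ≡ w ∷ h ∷ A′) ⊎ (∃ λ A′ → A ≡ A′ ++ h ∷ w ∷ [])

  IsEnd : List X → X → Set
  IsEnd A w = (∃ λ A′ → A ≡ w ∷ A′) ⊎ (∃ λ A′ → A ≡ A′ ++ [ w ])

  EndOfA⇒IsEnd : ∀ {A w h} → EndOfA A w h → IsEnd A w
  EndOfA⇒IsEnd (inj₁ refl) = inj₁ ([] , refl)
  EndOfA⇒IsEnd (inj₂ (inj₁ (A′ , refl))) = inj₁ (_ , refl)
  EndOfA⇒IsEnd {w = w} {h} (inj₂ (inj₂ (A′ , refl))) = inj₂ (A′ ++ [ h ] , sym (++-assoc A′ [ h ] [ w ]))

  at-most-two-ends : ∀ {A w₁ w₂ w} → w₁ ≢ w₂ → IsEnd A w₁ → IsEnd A w₂ → IsEnd A w → w ≡ w₁ ⊎ w ≡ w₂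
  at-most-two-ends w₁≢w₂ (inj₁ (_ , e₁)) (inj₁ (_ , e₂)) _ = ⊥-elim (w₁≢w₂ (∷-injectiveˡ (trans (sym e₁) e₂)))
  at-most-two-ends w₁≢w₂ (inj₂ (A₁ , e₁)) (inj₂ (A₂ , e₂)) _ = ⊥-elim (w₁≢w₂ (∷ʳ-injectiveʳ A₁ A₂ (trans (sym e₁) e₂)))
  at-most-two-ends _ (inj₁ (_ , e₁)) (inj₂ _) (inj₁ (_ , e)) = inj₁ (∷-injectiveˡ (trans (sym e) e₁))
  at-most-two-ends _ (inj₁ _) (inj₂ (A₂ , e₂)) (inj₂ (A , e)) = inj₂ (∷ʳ-injectiveʳ A A₂ (trans (sym e) e₂))
  at-most-two-ends _ (inj₂ (A₁ , e₁)) (inj₁ _) (inj₂ (A , e)) = inj₁ (∷ʳ-injectiveʳ A A₁ (trans (sym e) e₁))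
  at-most-two-ends _ (inj₂ _) (inj₁ (_ , e₂)) (inj₁ (_ , e)) = inj₂ (∷-injectiveˡ (trans (sym e) e₂))

  singleton≢snoc₂ : ∀ {w a b : X} A′ → [ w ] ≢ A′ ++ a ∷ b ∷ []
  singleton≢snoc₂ [] ()
  singleton≢snoc₂ (_ ∷ []) ()
  singleton≢snoc₂ (_ ∷ _ ∷ _) ()

  snoc₂-injective : ∀ {a b a′ b′ : X} A A′ → A ++ a ∷ b ∷ [] ≡ A′ ++ a′ ∷ b′ ∷ [] → b ≡ b′
  snoc₂-injective {a} {b} {a′} {b′} A A′ e = ∷ʳ-injectiveʳ (A ++ [ a ]) (A′ ++ [ a′ ])
    (trans (++-assoc A [ a ] [ b ]) (trans e (sym (++-assoc A′ [ a′ ] [ b′ ]))))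

  squeezed : ∀ {w y w′ : X} A A′ → Unique (w ∷ y ∷ A) → w ∷ y ∷ A ≡ A′ ++ y ∷ w′ ∷ [] → w ≢ y → A ≡ [ w′ ]
  squeezed A [] u e w≢y = ⊥-elim (w≢y (∷-injectiveˡ e))
  squeezed A (_ ∷ []) u e w≢y = ∷-injectiveʳ (∷-injectiveʳ e)
  squeezed {y = y} A (_ ∷ _ ∷ A″) u e w≢y =
    ⊥-elim (Unique[x∷xs]⇒x∉xs (unique-tail u) (subst (y ∈_) (sym (∷-injectiveʳ (∷-injectiveʳ e))) (∈-middle A″)))

module _ {A : Set} {R : A → A → Set} where

  linked-init : ∀ xs {a ys} → Linked R (xs ++ a ∷ ys) → Linked R (xs ++ [ a ])
  linked-init [] _ = [-]
  linked-init (x ∷ []) (r ∷ _) = r ∷ [-]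
  linked-init (x ∷ y ∷ xs) (r ∷ l) = r ∷ linked-init (y ∷ xs) l

  linked-from : ∀ xs {a ys} → Linked R (xs ++ a ∷ ys) → Linked R (a ∷ ys)
  linked-from [] l = l
  linked-from (x ∷ xs) l = linked-from xs (tail l)

  linked-join : ∀ xs {a ys} → Linked R (xs ++ [ a ]) → Linked R (a ∷ ys) → Linked R (xs ++ a ∷ ys)
  linked-join [] _ l = l
  linked-join (x ∷ []) (r ∷ _) l = r ∷ l
  linked-join (x ∷ y ∷ xs) (r ∷ l₁) l = r ∷ linked-join (y ∷ xs) l₁ l

  linked-last : ∀ xs {p a ys} → Linked R ((xs ++ [ p ]) ++ a ∷ ys) → R p a
  linked-last xs {p} {a} {ys} l = head (linked-from xs (subst (Linked R) (++-assoc xs [ p ] (a ∷ ys)) l))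

  linked-reverse : Symmetric R → ∀ {xs} → Linked R xs → Linked R (reverse xs)
  linked-reverse R-sym [] = []
  linked-reverse R-sym [-] = [-]
  linked-reverse R-sym {x ∷ y ∷ xs} (r ∷ l) =
    subst (Linked R) reverse-pair
      (linked-join (reverse xs) (subst (Linked R) (unfold-reverse y xs) (linked-reverse R-sym l)) (R-sym r ∷ [-]))
    where
    reverse-pair : reverse xs ++ y ∷ x ∷ [] ≡ reverse (x ∷ y ∷ xs)
    reverse-pair = trans (sym (++-assoc (reverse xs) [ y ] [ x ]))
      (trans (cong (_++ [ x ]) (sym (unfold-reverse y xs))) (sym (unfold-reverse x (y ∷ xs))))

-- Scattering along a path

module Scattering {V : Set} (_≟_ : DecidableEquality V) where

  countL : (V → Bool) → List V → ℕ
  countL p [] = 0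
  countL p (c ∷ L) = χ (p c) + countL p L

  occurs : V → List V → ℕ
  occurs o [] = 0
  occurs o (c ∷ L) = if does (c ≟ o) then 1 else occurs o L

  occurs≤1 : ∀ o L → occurs o L ≤ 1
  occurs≤1 o [] = z≤n
  occurs≤1 o (c ∷ L) with does (c ≟ o)
  ... | true = ≤-refl
  ... | false = occurs≤1 o L

  occurs-∈ : ∀ {o L} → o ∈ L → occurs o L ≡ 1
  occurs-∈ {o} {c ∷ L} o∈ with c ≟ o
  ... | yes _ = refl
  occurs-∈ {o} {c ∷ L} (here refl) | no c≢o = ⊥-elim (c≢o refl)
  occurs-∈ {o} {c ∷ L} (there o∈L) | no _ = occurs-∈ o∈L

  countL-at≥1 : ∀ {a L} → a ∈ L → 1 ≤ countL (λ c → does (c ≟ a)) L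
  countL-at≥1 {a} {c ∷ L} (here refl) rewrite dec-true (c ≟ c) refl = s≤s z≤n
  countL-at≥1 {a} {c ∷ L} (there a∈L) = ≤-trans (countL-at≥1 a∈L) (m≤n+m _ _)

  countL-at≤1 : ∀ a {L} → Unique L → countL (λ c → does (c ≟ a)) L ≤ 1
  countL-at≤1 a [] = z≤n
  countL-at≤1 a {c ∷ L} (c∉L ∷ u) with c ≟ a
  ... | no _ = countL-at≤1 a u
  ... | yes refl = s≤s (≤-reflexive (absent c∉L))
    where
    absent : ∀ {L} → All (c ≢_) L → countL (λ d → does (d ≟ c)) L ≡ 0
    absent [] = refl
    absent {d ∷ L} (c≢d ∷ all) with d ≟ c
    ... | yes d≡c = ⊥-elim (c≢d (sym d≡c))
    ... | no _ = absent all

  countL-∨ : ∀ p q L → (∀ c → χ (p c ∨ q c) ≡ χ (p c) + χ (q c)) →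
             countL (λ c → p c ∨ q c) L ≡ countL p L + countL q L
  countL-∨ p q [] h = refl
  countL-∨ p q (c ∷ L) h =
    trans (cong₂ _+_ (h c) (countL-∨ p q L h)) (interchange (χ (p c)) (χ (q c)) (countL p L) (countL q L))

  countL-∨≤ : ∀ p q L → countL (λ c → p c ∨ q c) L ≤ countL p L + countL q L
  countL-∨≤ p q [] = z≤n
  countL-∨≤ p q (c ∷ L) =
    ≤-trans (+-mono-≤ (χ-∨ (p c) (q c)) (countL-∨≤ p q L))
            (≤-reflexive (interchange (χ (p c)) (χ (q c)) (countL p L) (countL q L)))
    where
    χ-∨ : ∀ a b → χ (a ∨ b) ≤ χ a + χ b
    χ-∨ true b = m≤m+n 1 (χ b)
    χ-∨ false b = ≤-refl

  private
    +-≤-suc : ∀ {a b i} → a ≤ b → i ≤ 1 → a + i ≤ suc b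
    +-≤-suc {b = b} a≤b i≤1 = ≤-trans (+-mono-≤ a≤b i≤1) (≤-reflexive (+-comm b 1))

    if-≤1 : ∀ β {m} → m ≤ 1 → (if β then 1 else m) ≤ 1
    if-≤1 true _ = ≤-refl
    if-≤1 false m≤1 = m≤1

  module _ (isT isS : V → Bool) where

    Separated : V → V → Set
    Separated c d = (isT c ≡ true → isS d ≡ true) × (isT d ≡ true → isS c ≡ true)

    module _ (o : V) (o∉T : isT o ≡ false) (o∉S : isS o ≡ false)
             (T∩S≡∅ : ∀ c → isT c ≡ true → isS c ≡ false) where

      Invariant : V → List V → Set
      Invariant c L =
        (countL isT (c ∷ L) + occurs o (c ∷ L) ≤ suc (countL isS (c ∷ L))) ×
        (isS c ≡ true → countL isT (c ∷ L) + occurs o (c ∷ L) ≤ countL isS (c ∷ L)) ×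
        (isT c ≡ false → isS c ≡ false → countL isT (c ∷ L) ≤ countL isS (c ∷ L))

      invariant : ∀ c L → Linked Separated (c ∷ L) → Invariant c L
      invariant c L l with isT c in Tc | isS c in Sc | c ≟ o
      ... | true | _ | yes refl = ⊥-elim (clash Tc o∉T)
      ... | false | true | yes refl = ⊥-elim (clash Sc o∉S)
      ... | true | true | no _ = ⊥-elim (clash Sc (T∩S≡∅ c Tc))
      invariant c [] _ | true | false | no _ = ≤-refl , (λ ()) , (λ ())
      invariant c [] _ | false | true | no _ = z≤n , (λ _ → z≤n) , (λ _ ())
      invariant c [] _ | false | false | yes _ = ≤-refl , (λ ()) , (λ _ _ → z≤n)
      invariant c [] _ | false | false | no _ = z≤n , (λ ()) , (λ _ _ → z≤n)
      invariant c (d ∷ L) (r ∷ l) | true | false | no _ with isS d in Sd | isT d in Td | invariant d L l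
      ... | false | _ | _ with () ← proj₁ r Tc
      ... | true | true | _ = ⊥-elim (clash Sd (T∩S≡∅ d Td))
      ... | true | false | (_ , headS , _) = s≤s (headS refl) , (λ ()) , (λ ())
      invariant c (d ∷ L) (r ∷ l) | false | true | no _ with invariant d L l
      ... | (bound , _ , _) = ≤-trans bound (n≤1+n _) , (λ _ → bound) , (λ _ ())
      invariant c (d ∷ L) (r ∷ l) | false | false | c≟o with isT d in Td | isS d in Sd | invariant d L l
      ... | true | _ | _ = ⊥-elim (clash (proj₂ r refl) Sc)
      ... | false | true | (_ , headS , _) =
            +-≤-suc (≤-trans (m≤m+n _ _) (headS refl)) (if-≤1 (does c≟o) (occurs≤1 o (d ∷ L))) ,
            (λ ()) , (λ _ _ → ≤-trans (m≤m+n _ _) (headS refl))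
      ... | false | false | (_ , _ , headO) =
            +-≤-suc (headO refl refl) (if-≤1 (does c≟o) (occurs≤1 o (d ∷ L))) , (λ ()) , (λ _ _ → headO refl refl)

      -- Deleting the S-vertices cuts the path into at most |S| + 1 pieces; each T-vertex is a
      -- piece on its own, and the piece containing o has no T-vertex.
      scattering : ∀ {L} → Linked Separated L → o ∈ L → countL isT L ≤ countL isS L
      scattering {c ∷ L} l o∈L with proj₁ (invariant c L l)
      ... | bound rewrite occurs-∈ o∈L | +-comm (countL isT (c ∷ L)) 1 = ≤-pred bound

  open DecMembership _≟_ public using (_∈?_)

  countL-∈≥ : ∀ {Ts L} → Unique Ts → (∀ {t} → t ∈ Ts → t ∈ L) → length Ts ≤ countL (λ c → does (c ∈? Ts)) L
  countL-∈≥ [] Ts⊆L = z≤n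
  countL-∈≥ {t ∷ Ts} {L} (t∉Ts ∷ u) Ts⊆L =
    ≤-trans (+-mono-≤ (countL-at≥1 (Ts⊆L (here refl))) (countL-∈≥ u (λ t∈Ts → Ts⊆L (there t∈Ts))))
            (≤-reflexive (sym (countL-∨ (λ c → does (c ≟ t)) (λ c → does (c ∈? Ts)) L disjoint)))
    where
    disjoint : ∀ c → χ (does (c ≟ t) ∨ does (c ∈? Ts)) ≡ χ (does (c ≟ t)) + χ (does (c ∈? Ts))
    disjoint c with c ≟ t | c ∈? Ts
    ... | yes refl | yes c∈Ts = ⊥-elim (Unique[x∷xs]⇒x∉xs (t∉Ts ∷ u) c∈Ts)
    ... | yes _ | no _ = refl
    ... | no _ | _ = refl

  countL-∈≤ : ∀ Ss {L} → Unique L → countL (λ c → does (c ∈? Ss)) L ≤ length Ss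
  countL-∈≤ [] {L} u = ≤-reflexive (none L)
    where
    none : ∀ L → countL (λ c → does (c ∈? [])) L ≡ 0
    none [] = refl
    none (_ ∷ L) = none L
  countL-∈≤ (s ∷ Ss) {L} u =
    ≤-trans (countL-∨≤ (λ c → does (c ≟ s)) (λ c → does (c ∈? Ss)) L)
            (+-mono-≤ (countL-at≤1 s u) (countL-∈≤ Ss u))

  scattering-bound : ∀ {Ts Ss L o} → Unique L → Unique Ts → (∀ {t} → t ∈ Ts → t ∈ L) →
                     o ∈ L → o ∉ Ts → o ∉ Ss → (∀ {c} → c ∈ Ts → c ∉ Ss) →
                     Linked (Separated (λ c → does (c ∈? Ts)) (λ c → does (c ∈? Ss))) L →
                     length Ts ≤ length Ss
  scattering-bound {Ts} {Ss} {L} {o} uL uTs Ts⊆L o∈L o∉Ts o∉Ss Ts∩Ss≡∅ l =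
    ≤-trans (countL-∈≥ uTs Ts⊆L)
      (≤-trans (scattering isT isS o (dec-false (o ∈? Ts) o∉Ts) (dec-false (o ∈? Ss) o∉Ss) T∩S≡∅ l o∈L)
               (countL-∈≤ Ss uL))
    where
    isT isS : V → Bool
    isT c = does (c ∈? Ts)
    isS c = does (c ∈? Ss)
    T∩S≡∅ : ∀ c → isT c ≡ true → isS c ≡ false
    T∩S≡∅ c c∈Ts = dec-false (c ∈? Ss) (Ts∩Ss≡∅ (does⇒ (c ∈? Ts) c∈Ts))

<ᵇ-flip : ∀ a b → a ≢ b → not (a <ᵇ b) ≡ (b <ᵇ a)
<ᵇ-flip zero zero a≢b = ⊥-elim (a≢b refl)
<ᵇ-flip zero (suc b) _ = refl
<ᵇ-flip (suc a) zero _ = refl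
<ᵇ-flip (suc a) (suc b) a≢b = <ᵇ-flip a b (λ a≡b → a≢b (cong suc a≡b))

module _ {n} (G : Graph n) where

  private
    forward backward : Fin n → ℕ
    forward u = count (λ v → (toℕ u <ᵇ toℕ v) ∧ adj G u v)
    backward u = count (λ v → not (toℕ u <ᵇ toℕ v) ∧ adj G u v)

  handshake : sumFin (degree G) ≡ edges G + edges G
  handshake = begin
    sumFin (degree G)                            ≡⟨ sumFin-ext split ⟩
    sumFin (λ u → forward u + backward u)        ≡⟨ sumFin-+ forward backward ⟩
    edges G + sumFin backward                    ≡⟨ cong (edges G +_) backward-edges ⟩
    edges G + edges G                            ∎
    where
    open ≡-Reasoning
    split : ∀ u → degree G u ≡ forward u + backward u
    split u = trans (count-split (adj G u) (λ v → toℕ u <ᵇ toℕ v))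
                    (cong₂ _+_ (count-ext (λ v → ∧-comm (adj G u v) _)) (count-ext (λ v → ∧-comm (adj G u v) _)))
    flip-order : ∀ u v → not (toℕ u <ᵇ toℕ v) ∧ adj G u v ≡ (toℕ v <ᵇ toℕ u) ∧ adj G v u
    flip-order u v with adj G u v in uv | adj-sym G u v
    ... | false | vu = trans (∧-zeroʳ _) (sym (trans (cong (_ ∧_) (sym vu)) (∧-zeroʳ _)))
    ... | true | vu = trans (∧-identityʳ _) (trans (<ᵇ-flip (toℕ u) (toℕ v) u≢v)
                            (sym (trans (cong (_ ∧_) (sym vu)) (∧-identityʳ _))))
      where
      u≢v : toℕ u ≢ toℕ v
      u≢v eq with toℕ-injective eq
      ... | refl = clash uv (irrefl G u)
    backward-edges : sumFin backward ≡ edges G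
    backward-edges = trans (sumFin-ext (λ u → count-ext (flip-order u)))
                           (count-swap (λ u v → (toℕ v <ᵇ toℕ u) ∧ adj G v u))

module Degree2Nbrs {n} (G : Graph n) where

  deg2? : Fin n → Bool
  deg2? x = degree G x ≡ᵇ 2

  d₂ d₃ : Fin n → ℕ
  d₂ x = count (λ y → adj G x y ∧ deg2? y)
  d₃ x = count (λ y → adj G x y ∧ not (deg2? y))

  degree≡d₂+d₃ : ∀ x → degree G x ≡ d₂ x + d₃ x
  degree≡d₂+d₃ x = count-split (adj G x) deg2?

  sum-d₂ : sumFin d₂ ≡ count deg2? + count deg2?
  sum-d₂ = begin
    sumFin d₂                                        ≡⟨ count-swap (λ x y → adj G x y ∧ deg2? y) ⟩
    sumFin (λ y → count (λ x → adj G x y ∧ deg2? y)) ≡⟨ sumFin-ext column ⟩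
    sumFin (λ y → χ (deg2? y) + χ (deg2? y))         ≡⟨ sumFin-+ (λ y → χ (deg2? y)) (λ y → χ (deg2? y)) ⟩
    sumFin (λ y → χ (deg2? y)) + sumFin (λ y → χ (deg2? y))
                                                     ≡⟨ sym (cong₂ _+_ (count-as-sum deg2?) (count-as-sum deg2?)) ⟩
    count deg2? + count deg2?                        ∎
    where
    open ≡-Reasoning
    column : ∀ y → count (λ x → adj G x y ∧ deg2? y) ≡ χ (deg2? y) + χ (deg2? y)
    column y with deg2? y in deg2
    ... | false = count-false _ (λ x → ∧-zeroʳ (adj G x y))
    ... | true = trans (count-ext (λ x → trans (∧-identityʳ (adj G x y)) (adj-sym G x y)))
                       (does⇒ (degree G y ≟ℕ 2) deg2)

  edge-bound : (∀ x → deg2? x ≡ false → 3 ≤ d₃ x) → (∀ x → deg2? x ≡ true → 2 ≤ d₃ x) →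
               3 * n + count deg2? ≤ 2 * edges G
  edge-bound d₃≥3 d₃≥2 = begin
    3 * n + m                       ≡⟨ cong (_+ m) (sym sum-lower) ⟩
    sumFin lower + m + m            ≡⟨ +-assoc (sumFin lower) m m ⟩
    sumFin lower + (m + m)          ≤⟨ +-monoˡ-≤ (m + m) (sumFin-mono lower≤d₃) ⟩
    sumFin d₃ + (m + m)             ≡⟨ cong (sumFin d₃ +_) (sym sum-d₂) ⟩
    sumFin d₃ + sumFin d₂           ≡⟨ +-comm (sumFin d₃) (sumFin d₂) ⟩
    sumFin d₂ + sumFin d₃           ≡⟨ sym (sumFin-+ d₂ d₃) ⟩
    sumFin (λ x → d₂ x + d₃ x)      ≡⟨ sym (sumFin-ext degree≡d₂+d₃) ⟩
    sumFin (degree G)               ≡⟨ handshake G ⟩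
    edges G + edges G               ≡⟨ cong (edges G +_) (sym (+-identityʳ (edges G))) ⟩
    2 * edges G                     ∎
    where
    open ≤-Reasoning
    m = count deg2?
    lower : Fin n → ℕ
    lower x = if deg2? x then 2 else 3
    lower≤d₃ : ∀ x → lower x ≤ d₃ x
    lower≤d₃ x with deg2? x in deg2
    ... | true = d₃≥2 x deg2
    ... | false = d₃≥3 x deg2
    sum-lower : sumFin lower + m ≡ 3 * n
    sum-lower = begin-equality
      sumFin lower + m                            ≡⟨ cong (sumFin lower +_) (count-as-sum deg2?) ⟩
      sumFin lower + sumFin (λ x → χ (deg2? x))   ≡⟨ sym (sumFin-+ lower (λ x → χ (deg2? x))) ⟩
      sumFin (λ x → lower x + χ (deg2? x))        ≡⟨ sumFin-ext lower+χ≡3 ⟩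
      sumFin {n} (λ _ → 3)                        ≡⟨ sumFin-const n 3 ⟩
      n * 3                                       ≡⟨ *-comm n 3 ⟩
      3 * n                                       ∎
      where
      lower+χ≡3 : ∀ x → lower x + χ (deg2? x) ≡ 3
      lower+χ≡3 x with deg2? x
      ... | true = refl
      ... | false = refl

record Spanning {n} (L : List (Fin n)) : Set where
  field
    unique : Unique L
    length≡n : length L ≡ n

  covers : ∀ c → c ∈ L
  covers c = decidable-stable (DecMembership._∈?_ _≟_ c L) c∉L-absurd
    where
    others : Fin n → Bool
    others i = true ∧ not (does (i ≟ c))
    c∉L-absurd : c ∉ L → ⊥
    c∉L-absurd c∉L = ≤⇒≯ L≤others (≤-reflexive (sym L≡1+others))
      where
      L≤others : length L ≤ count others
      L≤others = length≤count others unique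
        (All.map (λ c≢i → ∧-not-does⇐ (_ ≟ c) refl (c≢i ∘ sym)) (¬Any⇒All¬ L c∉L))
      L≡1+others : length L ≡ suc (count others)
      L≡1+others = trans length≡n (trans (sym count-true) (count-remove (λ _ → true) c refl))

module _ {V : Set} where

  lookupPath : ∀ {k} (L : List V) → length L ≡ suc k → Fin (suc k) → V
  lookupPath (a ∷ L) _ fzero = a
  lookupPath {suc k} (a ∷ L) eq (fsuc i) = lookupPath L (suc-injective eq) i

  lookupPath-∈ : ∀ {k} L eq (i : Fin (suc k)) → lookupPath L eq i ∈ L
  lookupPath-∈ (a ∷ L) _ fzero = here refl
  lookupPath-∈ {suc k} (a ∷ L) eq (fsuc i) = there (lookupPath-∈ L (suc-injective eq) i)

  lookupPath-injective : ∀ {k} L eq → Unique L → {i j : Fin (suc k)} →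
                         lookupPath L eq i ≡ lookupPath L eq j → i ≡ j
  lookupPath-injective (a ∷ L) eq u {fzero} {fzero} _ = refl
  lookupPath-injective {suc k} (a ∷ L) eq u {fzero} {fsuc j} a≡ =
    ⊥-elim (Unique[x∷xs]⇒x∉xs u (subst (_∈ L) (sym a≡) (lookupPath-∈ L (suc-injective eq) j)))
  lookupPath-injective {suc k} (a ∷ L) eq u {fsuc i} {fzero} ≡a =
    ⊥-elim (Unique[x∷xs]⇒x∉xs u (subst (_∈ L) ≡a (lookupPath-∈ L (suc-injective eq) i)))
  lookupPath-injective {suc k} (a ∷ L) eq (_ ∷ u) {fsuc i} {fsuc j} e =
    cong fsuc (lookupPath-injective L (suc-injective eq) u e)

module _ {V : Set} {R : V → V → Set} where

  lookupPath-linked : ∀ {k} L eq → Linked R L → (i : Fin k) →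
                      R (lookupPath L eq (inject₁ i)) (lookupPath L eq (fsuc i))
  lookupPath-linked (a ∷ b ∷ L) eq (r ∷ l) fzero = r
  lookupPath-linked (a ∷ b ∷ L) eq (r ∷ l) (fsuc i) = lookupPath-linked (b ∷ L) (suc-injective eq) l i

  linked-tabulate : ∀ {k} (f : Fin (suc k) → V) → (∀ (i : Fin k) → R (f (inject₁ i)) (f (fsuc i))) →
                    Linked R (tabulate f)
  linked-tabulate {zero} f _ = [-]
  linked-tabulate {suc k} f h = h fzero ∷ linked-tabulate (λ i → f (fsuc i)) (λ i → h (fsuc i))

module _ {k} (G : Graph (suc k)) where

  traceable : ∀ {L} → Spanning L → Linked (Adjacent G) L → Traceable G
  traceable {L} S l =
    lookupPath L length≡n , lookupPath-injective L length≡n unique , lookupPath-linked L length≡n l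
    where open Spanning S

  hamiltonian-list : Traceable G → ∃ λ L → Spanning L × Linked (Adjacent G) L
  hamiltonian-list (p , p-injective , p-linked) =
    tabulate p , record { unique = tabulate⁺ p-injective ; length≡n = length-tabulate p } ,
    linked-tabulate p p-linked

Spanning-↭ : ∀ {n} {L Q : List (Fin n)} → L ↭ Q → Spanning L → Spanning Q
Spanning-↭ p S = record { unique = unique-resp-↭ p (Spanning.unique S)
                        ; length≡n = trans (sym (↭-length p)) (Spanning.length≡n S) }

-- Hamiltonian paths of G + uv

module MaximalNontraceableGraph {k} (G : Graph (suc k)) (mnt : MaximalNontraceable G) where

  open Spanning

  n : ℕ
  n = suc k

  V : Set
  V = Fin n

  _~_ : V → V → Set
  a ~ b = Adjacent G a b

  ~-sym : ∀ {a b} → a ~ b → b ~ a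
  ~-sym {a} {b} ab = trans (adj-sym G b a) ab

  ~-irrefl : ∀ {a b} → a ~ b → a ≢ b
  ~-irrefl {a} aa refl = clash aa (irrefl G a)

  ≁⇒false : ∀ {a b} → ¬ a ~ b → adj G a b ≡ false
  ≁⇒false {a} {b} a≁b with adj G a b in ab
  ... | true = ⊥-elim (a≁b refl)
  ... | false = refl

  OnlyNbrs : V → V → V → Set
  OnlyNbrs w a b = ∀ c → w ~ c → c ≡ a ⊎ c ≡ b

  OnlyNbrs-swap : ∀ {w a b} → OnlyNbrs w a b → OnlyNbrs w b a
  OnlyNbrs-swap N c wc = ⊎-swap (N c wc)

  not-hamiltonian : ∀ {L} → Spanning L → Linked _~_ L → ⊥
  not-hamiltonian S l = proj₁ mnt (traceable G S l)

  not-hamiltonian-↭ : ∀ {L} → Spanning L → ∀ Q → Q ↭ L → Linked _~_ Q → ⊥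
  not-hamiltonian-↭ S Q p l = not-hamiltonian (Spanning-↭ (↭-sym p) S) l

  too-short : ∀ {L} → 6 ≤ n → Spanning L → {True (length L ≤? 5)} → ⊥
  too-short n≥6 S {short} = ≤⇒≯ (toWitness short) (subst (6 ≤_) (sym (length≡n S)) n≥6)

  module Distinct {A B : List V} {u v : V} (S : Spanning (A ++ u ∷ v ∷ B)) where

    u∉A : u ∉ A
    u∉A u∈A = unique-disjoint A (unique S) u∈A (here refl)

    v∉A : v ∉ A
    v∉A v∈A = unique-disjoint A (unique S) v∈A (there (here refl))

    u∉B : u ∉ B
    u∉B u∈B = Unique[x∷xs]⇒x∉xs (unique-++ʳ A (unique S)) (there u∈B)

    v∉B : v ∉ B
    v∉B = Unique[x∷xs]⇒x∉xs (unique-tail (unique-++ʳ A (unique S)))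

    A∩B : ∀ {c} → c ∈ A → c ∈ B → ⊥
    A∩B c∈A c∈B = unique-disjoint A (unique S) c∈A (there (there c∈B))

    u≢v : u ≢ v
    u≢v refl = Unique[x∷xs]⇒x∉xs (unique-++ʳ A (unique S)) (here refl)

    unique-B : Unique B
    unique-B = unique-tail (unique-tail (unique-++ʳ A (unique S)))

  locate : ∀ {u v : V} A B c → c ∈ A ++ u ∷ v ∷ B → c ∈ A ⊎ c ≡ u ⊎ c ≡ v ⊎ c ∈ B
  locate A B c c∈ with ∈-++⁻ A c∈
  ... | inj₁ c∈A = inj₁ c∈A
  ... | inj₂ (here c≡u) = inj₂ (inj₁ c≡u)
  ... | inj₂ (there (here c≡v)) = inj₂ (inj₂ (inj₁ c≡v))
  ... | inj₂ (there (there c∈B)) = inj₂ (inj₂ (inj₂ c∈B))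

  -- A Hamiltonian path A u v B of G + uv through the new edge, cut at that edge.
  record PathVia (u v : V) : Set where
    constructor via
    field
      A B : List V
      spanning : Spanning (A ++ u ∷ v ∷ B)
      linkedA : Linked _~_ (A ++ [ u ])
      linkedB : Linked _~_ (v ∷ B)

  PathVia-reverse : ∀ {u v} → PathVia u v → PathVia v u
  PathVia-reverse {u} {v} (via A B S lA lB) =
    via (reverse B) (reverse A) (Spanning-↭ (↭-sym reversed) S)
        (subst (Linked _~_) (unfold-reverse v B) (linked-reverse ~-sym lB))
        (subst (Linked _~_) (reverse-++ A [ u ]) (linked-reverse ~-sym lA))
    where
    reverse-split : reverse (A ++ u ∷ v ∷ B) ≡ reverse B ++ v ∷ u ∷ reverse A
    reverse-split = trans (reverse-++ A (u ∷ v ∷ B)) (trans (cong (_++ reverse A) (unfold-reverse u (v ∷ B)))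
      (trans (cong (λ L → (L ++ [ u ]) ++ reverse A) (unfold-reverse v B))
      (trans (++-assoc (reverse B ++ [ v ]) [ u ] (reverse A)) (++-assoc (reverse B) [ v ] (u ∷ reverse A)))))
    reversed : reverse B ++ v ∷ u ∷ reverse A ↭ A ++ u ∷ v ∷ B
    reversed = subst (_↭ A ++ u ∷ v ∷ B) reverse-split (↭-reverse (A ++ u ∷ v ∷ B))

  AdjPlus : V → V → V → V → Set
  AdjPlus u v a b = a ~ b ⊎ (a ≡ u × b ≡ v) ⊎ (a ≡ v × b ≡ u)

  AdjPlus-sym : ∀ {u v a b} → AdjPlus u v a b → AdjPlus u v b a
  AdjPlus-sym (inj₁ ab) = inj₁ (~-sym ab)
  AdjPlus-sym (inj₂ (inj₁ (a≡u , b≡v))) = inj₂ (inj₂ (b≡v , a≡u))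
  AdjPlus-sym (inj₂ (inj₂ (a≡v , b≡u))) = inj₂ (inj₁ (b≡u , a≡v))

  addEdge-adjacent : ∀ {u v} (u≢v : u ≢ v) {a b} → Adjacent (addEdge G u v u≢v) a b → AdjPlus u v a b
  addEdge-adjacent {u} {v} u≢v {a} {b} ab with adj G a b in e
  ... | true = inj₁ refl
  ... | false with a ≟ u | b ≟ v | a ≟ v | b ≟ u
  ... | yes a≡u | yes b≡v | _ | _ = inj₂ (inj₁ (a≡u , b≡v))
  ... | _ | _ | yes a≡v | yes b≡u = inj₂ (inj₂ (a≡v , b≡u))
  ... | yes _ | no _ | no _ | _ = ⊥-elim (clash ab refl)
  ... | yes _ | no _ | yes _ | no _ = ⊥-elim (clash ab refl)
  ... | no _ | _ | no _ | _ = ⊥-elim (clash ab refl)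
  ... | no _ | _ | yes _ | no _ = ⊥-elim (clash ab refl)

  PathVia-linked : ∀ {u v} (P : PathVia u v) → Linked (AdjPlus u v) (PathVia.A P ++ u ∷ v ∷ PathVia.B P)
  PathVia-linked (via A B _ lA lB) = linked-join A (Linked.map inj₁ lA) (inj₂ (inj₁ (refl , refl)) ∷ Linked.map inj₁ lB)

  private
    split-at-new-edge : ∀ {u v} (P : List V) → Linked (AdjPlus u v) P →
      Linked _~_ P ⊎
      (∃₂ λ A B → P ≡ A ++ u ∷ v ∷ B × Linked _~_ (A ++ [ u ]) × Linked (AdjPlus u v) (v ∷ B)) ⊎
      (∃₂ λ A B → P ≡ A ++ v ∷ u ∷ B × Linked _~_ (A ++ [ v ]) × Linked (AdjPlus u v) (u ∷ B))
    split-at-new-edge [] _ = inj₁ []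
    split-at-new-edge (a ∷ []) _ = inj₁ [-]
    split-at-new-edge (a ∷ b ∷ P) (inj₂ (inj₁ (refl , refl)) ∷ l) = inj₂ (inj₁ ([] , P , refl , [-] , l))
    split-at-new-edge (a ∷ b ∷ P) (inj₂ (inj₂ (refl , refl)) ∷ l) = inj₂ (inj₂ ([] , P , refl , [-] , l))
    split-at-new-edge (a ∷ b ∷ P) (inj₁ r ∷ l) with split-at-new-edge (b ∷ P) l
    ... | inj₁ l′ = inj₁ (r ∷ l′)
    ... | inj₂ (inj₁ ([] , B , refl , lA , lB)) = inj₂ (inj₁ (a ∷ [] , B , refl , r ∷ lA , lB))
    ... | inj₂ (inj₁ (c ∷ A , B , refl , lA , lB)) = inj₂ (inj₁ (a ∷ c ∷ A , B , refl , r ∷ lA , lB))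
    ... | inj₂ (inj₂ ([] , B , refl , lA , lB)) = inj₂ (inj₂ (a ∷ [] , B , refl , r ∷ lA , lB))
    ... | inj₂ (inj₂ (c ∷ A , B , refl , lA , lB)) = inj₂ (inj₂ (a ∷ c ∷ A , B , refl , r ∷ lA , lB))

    linked-avoiding : ∀ {u v} c (L : List V) → Linked (AdjPlus u v) (c ∷ L) → u ∉ L → v ∉ L → Linked _~_ (c ∷ L)
    linked-avoiding c [] _ _ _ = [-]
    linked-avoiding c (b ∷ L) (inj₁ r ∷ l) u∉ v∉ = r ∷ linked-avoiding b L l (u∉ ∘ there) (v∉ ∘ there)
    linked-avoiding c (b ∷ L) (inj₂ (inj₁ (_ , refl)) ∷ l) u∉ v∉ = ⊥-elim (v∉ (here refl))
    linked-avoiding c (b ∷ L) (inj₂ (inj₂ (_ , refl)) ∷ l) u∉ v∉ = ⊥-elim (u∉ (here refl))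

  pathVia : ∀ u v → u ≢ v → adj G u v ≡ false → PathVia u v
  pathVia u v u≢v uv with hamiltonian-list (addEdge G u v u≢v) (proj₂ mnt u v u≢v uv)
  ... | P , S , l with split-at-new-edge P (Linked.map (addEdge-adjacent u≢v) l)
  ... | inj₁ l′ = ⊥-elim (not-hamiltonian S l′)
  ... | inj₂ (inj₁ (A , B , refl , lA , lB)) = via A B S lA (linked-avoiding v B lB u∉B v∉B)
    where open Distinct S
  ... | inj₂ (inj₂ (A , B , refl , lA , lB)) = PathVia-reverse (via A B S lA (linked-avoiding u B lB v∉B u∉B))
    where open Distinct S

  private
    -- The path-predecessor of w lies in N(w) = {a, b}, so w follows b; its successor would be a
    -- third neighbour, so w is last and A a w b is a Hamiltonian path of G.
    deg2-not-after : ∀ {a b w} → w ~ a → OnlyNbrs w a b → (P : PathVia a b) → w ∈ PathVia.B P → ⊥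
    deg2-not-after {a} {b} {w} wa Nw (via A B S lA lB) w∈B with ∈-∃++ w∈B
    ... | B1 , B2 , refl with initLast B1
    ...   | B1′ ∷ʳ′ p with Nw p (~-sym (linked-last (b ∷ B1′) lB))
    ...     | inj₁ refl = Distinct.u∉B S (∈-last B1′ (w ∷ B2))
    ...     | inj₂ refl = Distinct.v∉B S (∈-last B1′ (w ∷ B2))
    deg2-not-after {a} {b} {w} wa Nw (via A B S lA lB) w∈B | B1 , B2 , refl | [] with B2
    ... | [] = not-hamiltonian-↭ S (A ++ a ∷ w ∷ b ∷ []) (++⁺ˡ A (↭-prep a (↭-swap w b ↭-refl)))
                 (linked-join A lA (~-sym wa ∷ ~-sym (head lB) ∷ [-]))
    ... | d ∷ B2′ with Nw d (head (tail lB))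
    ...   | inj₁ refl = Distinct.u∉B S (there (here refl))
    ...   | inj₂ refl = Distinct.v∉B S (there (here refl))

  deg2-nbrs-adjacent : ∀ {a b w} → a ≢ b → w ~ a → w ~ b → OnlyNbrs w a b → a ~ b
  deg2-nbrs-adjacent {a} {b} {w} a≢b wa wb Nw with adj G a b in ab
  ... | true = refl
  ... | false with pathVia a b a≢b ab
  ... | P@(via A B S _ _) with locate A B w (covers S w)
  ... | inj₁ w∈A = ⊥-elim (deg2-not-after wb (OnlyNbrs-swap Nw) (PathVia-reverse P) (reverse⁺ w∈A))
  ... | inj₂ (inj₁ refl) = ⊥-elim (~-irrefl wa refl)
  ... | inj₂ (inj₂ (inj₁ refl)) = ⊥-elim (~-irrefl wb refl)
  ... | inj₂ (inj₂ (inj₂ w∈B)) = ⊥-elim (deg2-not-after wa Nw P w∈B)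

  -- Otherwise rotating the path at x gives the Hamiltonian path A x l … r of G.
  last-not-adjacent : ∀ {x r} (P : PathVia x r) → ∀ B′ l → PathVia.B P ≡ B′ ++ [ l ] → ¬ x ~ l
  last-not-adjacent {x} {r} (via A B S lA lB) B′ l refl xl =
    not-hamiltonian-↭ S (A ++ x ∷ l ∷ reverse (r ∷ B′)) (++⁺ˡ A (↭-prep x reversed))
      (linked-join A lA (xl ∷ subst (Linked _~_) reverse-snoc (linked-reverse ~-sym lB)))
    where
    reverse-snoc : reverse (r ∷ B′ ++ [ l ]) ≡ l ∷ reverse (r ∷ B′)
    reverse-snoc = reverse-++ (r ∷ B′) [ l ]
    reversed : l ∷ reverse (r ∷ B′) ↭ r ∷ B′ ++ [ l ]
    reversed = subst (_↭ r ∷ B′ ++ [ l ]) reverse-snoc (↭-reverse (r ∷ B′ ++ [ l ]))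

  deg2-nbr-at-end : ∀ {x r w h} → adj G x r ≡ false → x ~ h → w ~ x → OnlyNbrs w x h →
                    (P : PathVia x r) → EndOfA (PathVia.A P) w h
  deg2-nbr-at-end {x} {r} {w} {h} xr xh wx Nw (via A B S lA lB) with locate A B w (covers S w)
  ... | inj₂ (inj₁ refl) = ⊥-elim (~-irrefl wx refl)
  ... | inj₂ (inj₂ (inj₁ refl)) = ⊥-elim (clash (~-sym wx) xr)
  ... | inj₂ (inj₂ (inj₂ w∈B)) with ∈-∃++ w∈B
  ...   | B1 , [] , refl = ⊥-elim (last-not-adjacent (via A (B1 ++ [ w ]) S lA lB) B1 w refl (~-sym wx))
  ...   | B1 , d ∷ B2′ , refl with Nw d (head (linked-from (r ∷ B1) lB))
  ...     | inj₁ refl = ⊥-elim (Distinct.u∉B S (∈-++⁺ʳ B1 (there (here refl))))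
  ...     | inj₂ refl with initLast B1
  ...       | [] with Nw r (~-sym (head lB))
  ...         | inj₁ refl = ⊥-elim (Distinct.u≢v S refl)
  ...         | inj₂ refl = ⊥-elim (clash xh xr)
  deg2-nbr-at-end {x} {r} {w} {h} xr xh wx Nw (via A B S lA lB)
    | inj₂ (inj₂ (inj₂ w∈B)) | B1 , d ∷ B2′ , refl | inj₂ refl | B1′ ∷ʳ′ p
    with Nw p (~-sym (linked-last (r ∷ B1′) lB))
  ...         | inj₁ refl = ⊥-elim (Distinct.u∉B S (∈-last B1′ (w ∷ d ∷ B2′)))
  ...         | inj₂ refl = ⊥-elim (unique-disjoint (B1′ ++ [ p ]) (Distinct.unique-B S)
                                  (∈-middle B1′) (there (here refl)))
  deg2-nbr-at-end {x} {r} {w} {h} xr xh wx Nw (via A B S lA lB) | inj₁ w∈A with ∈-∃++ w∈A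
  ... | A1 , [] , refl with initLast A1
  ...   | [] = inj₁ refl
  ...   | A1′ ∷ʳ′ p with Nw p (~-sym (linked-last A1′ (subst (Linked _~_) (++-assoc (A1′ ++ [ p ]) [ w ] [ x ]) lA)))
  ...     | inj₁ refl = ⊥-elim (Distinct.u∉A S (∈-last A1′ (w ∷ [])))
  ...     | inj₂ refl = inj₂ (inj₂ (A1′ , ++-assoc A1′ [ p ] (w ∷ [])))
  deg2-nbr-at-end {x} {r} {w} {h} xr xh wx Nw (via A B S lA lB) | inj₁ w∈A | A1 , d ∷ A2′ , refl
    with Nw d (head (linked-from A1 (subst (Linked _~_) (++-assoc A1 (w ∷ d ∷ A2′) [ x ]) lA)))
  ...   | inj₁ refl = ⊥-elim (Distinct.u∉A S (∈-++⁺ʳ A1 (there (here refl))))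
  ...   | inj₂ refl with initLast A1
  ...     | [] = inj₂ (inj₁ (A2′ , refl))
  ...     | A1′ ∷ʳ′ p
    with Nw p (~-sym (linked-last A1′ (linked-init (A1′ ++ [ p ]) {w} {d ∷ A2′ ++ [ x ]}
                (subst (Linked _~_) (++-assoc (A1′ ++ [ p ]) (w ∷ d ∷ A2′) [ x ]) lA))))
  ...       | inj₁ refl = ⊥-elim (Distinct.u∉A S (∈-last A1′ (w ∷ d ∷ A2′)))
  ...       | inj₂ refl = ⊥-elim (unique-disjoint (A1′ ++ [ p ]) (unique-++ˡ ((A1′ ++ [ p ]) ++ w ∷ p ∷ A2′) (unique S))
                                  (∈-middle A1′) (there (here refl)))

  private
    through-twins : ∀ {x c w y w′ B} → Spanning (w ∷ y ∷ w′ ∷ x ∷ c ∷ B) → Linked _~_ (c ∷ B) →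
                    w ~ x → w′ ~ x → w′ ~ y → y ~ c → ⊥
    through-twins {x} {c} {w} {y} {w′} {B} S lB wx w′x w′y yc =
      not-hamiltonian-↭ S (w ∷ x ∷ w′ ∷ y ∷ c ∷ B)
        (↭-prep w (↭-trans (↭-swap x w′ ↭-refl) (↭-trans (↭-prep w′ (↭-swap x y ↭-refl)) (↭-swap w′ y ↭-refl))))
        (wx ∷ ~-sym w′x ∷ w′y ∷ yc ∷ lB)

  twins-N[y]⊆N[x] : ∀ {x y w₁ w₂ c} → w₁ ≢ w₂ → x ~ y →
                    w₁ ~ x → w₁ ~ y → OnlyNbrs w₁ x y → w₂ ~ x → w₂ ~ y → OnlyNbrs w₂ x y →
                    c ≢ x → adj G x c ≡ false → ¬ y ~ c
  twins-N[y]⊆N[x] {x} {y} {w₁} {w₂} {c} w₁≢w₂ xy w₁x w₁y N₁ w₂x w₂y N₂ c≢x xc yc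
    with pathVia x c (≢-sym c≢x) xc
  ... | P@(via A B S _ lB) with deg2-nbr-at-end xc xy w₁x N₁ P | deg2-nbr-at-end xc xy w₂x N₂ P
  ... | inj₁ refl | inj₁ refl = w₁≢w₂ refl
  ... | inj₁ refl | inj₂ (inj₂ (A′ , e)) = singleton≢snoc₂ A′ e
  ... | inj₂ (inj₂ (A′ , e)) | inj₁ refl = singleton≢snoc₂ A′ e
  ... | inj₂ (inj₁ (_ , refl)) | inj₂ (inj₁ (_ , refl)) = w₁≢w₂ refl
  ... | inj₂ (inj₂ (A₁ , e₁)) | inj₂ (inj₂ (A₂ , e₂)) = w₁≢w₂ (snoc₂-injective A₁ A₂ (trans (sym e₁) e₂))
  ... | inj₂ (inj₁ (A′ , refl)) | inj₂ (inj₂ (A″ , e))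
    with refl ← squeezed A′ A″ (unique-++ˡ (w₁ ∷ y ∷ A′) (unique S)) e (~-irrefl w₁y)
    = through-twins S lB w₁x w₂x w₂y yc
  ... | inj₂ (inj₂ (A″ , e)) | inj₂ (inj₁ (A′ , refl))
    with refl ← squeezed A′ A″ (unique-++ˡ (w₂ ∷ y ∷ A′) (unique S)) e (~-irrefl w₂y)
    = through-twins S lB w₂x w₁x w₁y yc

  OnlyNbrs₃ : V → V → V → V → Set
  OnlyNbrs₃ v a b c = ∀ d → v ~ d → d ≡ a ⊎ d ≡ b ⊎ d ≡ c

  OnlyNbrs₄ : V → V → V → V → V → Set
  OnlyNbrs₄ v a b c e = ∀ d → v ~ d → d ≡ a ⊎ d ≡ b ⊎ d ≡ c ⊎ d ≡ e

  record TwinsConfig (s s′ z w₁ w₂ : V) : Set where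
    field
      s~s′ : s ~ s′
      w₁~s : w₁ ~ s
      w₁~s′ : w₁ ~ s′
      w₂~s : w₂ ~ s
      w₂~s′ : w₂ ~ s′
      N[w₁] : OnlyNbrs w₁ s s′
      N[w₂] : OnlyNbrs w₂ s s′
      N[s] : OnlyNbrs₄ s s′ z w₁ w₂
      N[s′] : OnlyNbrs₄ s′ s z w₁ w₂

  TwinsConfig-swap : ∀ {s s′ z w₁ w₂} → TwinsConfig s s′ z w₁ w₂ → TwinsConfig s′ s z w₁ w₂
  TwinsConfig-swap T = record
    { s~s′ = ~-sym s~s′ ; w₁~s = w₁~s′ ; w₁~s′ = w₁~s ; w₂~s = w₂~s′ ; w₂~s′ = w₂~s
    ; N[w₁] = OnlyNbrs-swap N[w₁] ; N[w₂] = OnlyNbrs-swap N[w₂] ; N[s] = N[s′] ; N[s′] = N[s] }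
    where open TwinsConfig T

  TwinsConfig-swapTwins : ∀ {s s′ z w₁ w₂} → TwinsConfig s s′ z w₁ w₂ → TwinsConfig s s′ z w₂ w₁
  TwinsConfig-swapTwins T = record
    { s~s′ = s~s′ ; w₁~s = w₂~s ; w₁~s′ = w₂~s′ ; w₂~s = w₁~s ; w₂~s′ = w₁~s′
    ; N[w₁] = N[w₂] ; N[w₂] = N[w₁] ; N[s] = λ c sc → swap-last (N[s] c sc) ; N[s′] = λ c sc → swap-last (N[s′] c sc) }
    where
    open TwinsConfig T
    swap-last : ∀ {c a b d e : V} → c ≡ a ⊎ c ≡ b ⊎ c ≡ d ⊎ c ≡ e → c ≡ a ⊎ c ≡ b ⊎ c ≡ e ⊎ c ≡ d
    swap-last (inj₁ c≡a) = inj₁ c≡a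
    swap-last (inj₂ (inj₁ c≡b)) = inj₂ (inj₁ c≡b)
    swap-last (inj₂ (inj₂ (inj₁ c≡d))) = inj₂ (inj₂ (inj₂ c≡d))
    swap-last (inj₂ (inj₂ (inj₂ c≡e))) = inj₂ (inj₂ (inj₁ c≡e))

  open TwinsConfig

  -- Each configuration below is refuted by locating its vertices on a Hamiltonian path of G + uv
  -- for a suitable non-edge uv and rearranging that path into a Hamiltonian path of G.
  module _ (n≥6 : 6 ≤ n) where

    private
      path-w₂sw₁s′ : ∀ {s s′ z w₁ w₂ B} → Spanning (w₁ ∷ w₂ ∷ s ∷ s′ ∷ B) → TwinsConfig s s′ z w₁ w₂ → Linked _~_ (s′ ∷ B) → ⊥
      path-w₂sw₁s′ {s} {s′} {z} {w₁} {w₂} {B} S T lB = not-hamiltonian-↭ S (w₂ ∷ s ∷ w₁ ∷ s′ ∷ B)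
        (↭-sym (↭-trans (↭-swap w₁ w₂ ↭-refl) (↭-prep w₂ (↭-swap w₁ s ↭-refl))))
        (w₂~s T ∷ ~-sym (w₁~s T) ∷ w₁~s′ T ∷ lB)

      twins-first : ∀ {s s′ z w₁ w₂ B} → TwinsConfig s s′ z w₁ w₂ →
                    Spanning (w₁ ∷ w₂ ∷ s ∷ B) → Linked _~_ (w₂ ∷ s ∷ B) → ⊥
      twins-first {B = []} T S _ = too-short n≥6 S
      twins-first {s} {s′} {z} {w₁} {w₂} {t ∷ B} T S lB with N[s] T t (head (tail lB))
      ... | inj₁ refl = path-w₂sw₁s′ S T (tail (tail lB))
      ... | inj₂ (inj₂ (inj₁ refl)) = Distinct.u∉B {A = []} S (there (here refl))
      ... | inj₂ (inj₂ (inj₂ refl)) = Distinct.v∉B {A = []} S (there (here refl))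
      ... | inj₂ (inj₁ refl) with z ≟ s′
      ...   | yes refl = path-w₂sw₁s′ S T (tail (tail lB))
      ...   | no z≢s′ = s′-nowhere (covers S s′)
        where
        s′-nowhere : s′ ∉ w₁ ∷ w₂ ∷ s ∷ z ∷ B
        s′-nowhere (here refl) = ~-irrefl (w₁~s′ T) refl
        s′-nowhere (there (here refl)) = ~-irrefl (w₂~s′ T) refl
        s′-nowhere (there (there (here refl))) = ~-irrefl (s~s′ T) refl
        s′-nowhere (there (there (there (here refl)))) = z≢s′ refl
        s′-nowhere (there (there (there (there s′∈B)))) with ∈-∃++ s′∈B
        ... | C₁ , C₂ , refl with initLast C₁
        ...   | C₁′ ∷ʳ′ p with N[s′] T p (~-sym (linked-last (w₂ ∷ s ∷ z ∷ C₁′) lB))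
        ...     | inj₁ refl = Unique[x∷xs]⇒x∉xs (unique-tail (unique-tail (unique S))) (there (∈-last C₁′ (s′ ∷ C₂)))
        ...     | inj₂ (inj₁ refl) = Unique[x∷xs]⇒x∉xs (unique-tail (unique-tail (unique-tail (unique S)))) (∈-last C₁′ (s′ ∷ C₂))
        ...     | inj₂ (inj₂ (inj₁ refl)) = Unique[x∷xs]⇒x∉xs (unique S) (there (there (there (∈-last C₁′ (s′ ∷ C₂)))))
        ...     | inj₂ (inj₂ (inj₂ refl)) = Unique[x∷xs]⇒x∉xs (unique-tail (unique S)) (there (there (∈-last C₁′ (s′ ∷ C₂))))
        s′-nowhere (there (there (there (there s′∈B)))) | [] , [] , refl | [] = too-short n≥6 S
        s′-nowhere (there (there (there (there s′∈B)))) | [] , d ∷ C₂ , refl | []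
          with N[s′] T d (head (linked-from (w₂ ∷ s ∷ z ∷ []) lB))
        ... | inj₁ refl = Unique[x∷xs]⇒x∉xs (unique-tail (unique-tail (unique S))) (there (there (here refl)))
        ... | inj₂ (inj₁ refl) = Unique[x∷xs]⇒x∉xs (unique-tail (unique-tail (unique-tail (unique S)))) (there (here refl))
        ... | inj₂ (inj₂ (inj₁ refl)) = Unique[x∷xs]⇒x∉xs (unique S) (there (there (there (there (here refl)))))
        ... | inj₂ (inj₂ (inj₂ refl)) = Unique[x∷xs]⇒x∉xs (unique-tail (unique S)) (there (there (there (here refl))))

      twins-start : ∀ {s s′ z w₁ w₂ B} → TwinsConfig s s′ z w₁ w₂ →
                    Spanning (w₁ ∷ w₂ ∷ B) → Linked _~_ (w₂ ∷ B) → ⊥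
      twins-start {B = []} T S _ = too-short n≥6 S
      twins-start {B = b ∷ B} T S lB with N[w₂] T b (head lB)
      ... | inj₁ refl = twins-first T S lB
      ... | inj₂ refl = twins-first (TwinsConfig-swap T) S lB

      twins-inside : ∀ {s s′ z w₁ w₂} → TwinsConfig s s′ z w₁ w₂ → ∀ A B →
                     Spanning ((A ++ [ s ]) ++ w₁ ∷ w₂ ∷ s′ ∷ B) →
                     Linked _~_ ((A ++ [ s ]) ++ [ w₁ ]) → Linked _~_ (w₂ ∷ s′ ∷ B) → ⊥
      twins-inside {s} {s′} {z} {w₁} {w₂} T A B S lA lB with initLast A
      ... | [] = not-hamiltonian-↭ S (w₁ ∷ s ∷ w₂ ∷ s′ ∷ B) (↭-swap w₁ s ↭-refl)
                   (w₁~s T ∷ ~-sym (w₂~s T) ∷ w₂~s′ T ∷ tail lB)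
      twins-inside {s} {s′} {z} {w₁} {w₂} T A [] S lA lB | A′ ∷ʳ′ p =
        not-hamiltonian-↭ S (X ++ s ∷ w₁ ∷ s′ ∷ w₂ ∷ [])
          (subst (X ++ s ∷ w₁ ∷ s′ ∷ w₂ ∷ [] ↭_) (sym (++-assoc X [ s ] (w₁ ∷ w₂ ∷ s′ ∷ [])))
             (++⁺ˡ X (↭-prep s (↭-prep w₁ (↭-swap s′ w₂ ↭-refl)))))
          (linked-join X (linked-init X (subst (Linked _~_) (++-assoc X [ s ] [ w₁ ]) lA))
             (~-sym (w₁~s T) ∷ w₁~s′ T ∷ ~-sym (w₂~s′ T) ∷ [-]))
        where
        X = A′ ++ [ p ]
      twins-inside {s} {s′} {z} {w₁} {w₂} T A (d ∷ B) S lA lB | A′ ∷ʳ′ p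
        with N[s] T p (~-sym (linked-last A′ (subst (Linked _~_) (++-assoc (A′ ++ [ p ]) [ s ] [ w₁ ]) lA)))
      ... | inj₁ refl = Distinct.A∩B S (∈-last A′ [ s ]) (here refl)
      ... | inj₂ (inj₂ (inj₁ refl)) = Distinct.u∉A S (∈-last A′ [ s ])
      ... | inj₂ (inj₂ (inj₂ refl)) = Distinct.v∉A S (∈-last A′ [ s ])
      ... | inj₂ (inj₁ refl) with N[s′] T d (head (tail lB))
      ...   | inj₁ refl = Distinct.A∩B S (∈-middle (A′ ++ [ p ])) (there (here refl))
      ...   | inj₂ (inj₁ refl) = Distinct.A∩B S (∈-last A′ [ s ]) (there (here refl))
      ...   | inj₂ (inj₂ (inj₁ refl)) = Distinct.u∉B S (there (here refl))
      ...   | inj₂ (inj₂ (inj₂ refl)) = Distinct.v∉B S (there (here refl))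

      twins-path : ∀ {s s′ z w₁ w₂} → TwinsConfig s s′ z w₁ w₂ → ∀ A B →
                   Spanning (A ++ w₁ ∷ w₂ ∷ B) → Linked _~_ (A ++ [ w₁ ]) → Linked _~_ (w₂ ∷ B) → ⊥
      twins-path T A B S lA lB with initLast A
      ... | [] = twins-start T S lB
      twins-path T A [] S lA lB | A′ ∷ʳ′ p =
        twins-start (TwinsConfig-swapTwins T) (PathVia.spanning reversed) (PathVia.linkedB reversed)
        where
        reversed = PathVia-reverse (via (A′ ++ [ p ]) [] S lA lB)
      twins-path T A (q ∷ B) S lA lB | A′ ∷ʳ′ p with N[w₁] T p (~-sym (linked-last A′ lA)) | N[w₂] T q (head lB)
      ... | inj₁ refl | inj₁ refl = Distinct.A∩B S (∈-middle A′) (here refl)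
      ... | inj₂ refl | inj₂ refl = Distinct.A∩B S (∈-middle A′) (here refl)
      ... | inj₁ refl | inj₂ refl = twins-inside T A′ B S lA lB
      ... | inj₂ refl | inj₁ refl = twins-inside (TwinsConfig-swap T) A′ B S lA lB

    no-TwinsConfig : ∀ {s s′ z w₁ w₂} → TwinsConfig s s′ z w₁ w₂ → w₁ ≢ w₂ → ⊥
    no-TwinsConfig {w₁ = w₁} {w₂} T w₁≢w₂ with adj G w₁ w₂ in w₁w₂
    ... | true with N[w₁] T w₂ w₁w₂
    ...   | inj₁ refl = ~-irrefl (w₂~s T) refl
    ...   | inj₂ refl = ~-irrefl (w₂~s′ T) refl
    no-TwinsConfig T w₁≢w₂ | false with pathVia _ _ w₁≢w₂ w₁w₂
    ... | via A B S lA lB = twins-path T A B S lA lB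

    module SingleDeg2Nbr {x w y z : V} (wx : w ~ x) (wy : w ~ y) (N[w] : OnlyNbrs w x y) (xz : x ~ z)
                         (N[x] : OnlyNbrs₃ x w y z) where

      private
        NoPath : List V → List V → Set
        NoPath A B = Spanning (A ++ w ∷ z ∷ B) → Linked _~_ (A ++ [ w ]) → Linked _~_ (z ∷ B) → ⊥

        x-after-z : ∀ A B2 → NoPath A (x ∷ B2)
        x-after-z A B2 S lA lB with initLast A
        x-after-z A [] S lA lB | [] = too-short n≥6 S
        x-after-z A (d ∷ B3) S lA lB | [] with N[x] d (head (tail lB))
        ... | inj₁ refl = Distinct.u∉B {A = []} S (there (here refl))
        ... | inj₂ (inj₂ refl) = Distinct.v∉B {A = []} S (there (here refl))
        ... | inj₂ (inj₁ refl) = not-hamiltonian-↭ S (z ∷ x ∷ w ∷ d ∷ B3)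
              (↭-sym (↭-trans (↭-swap w z ↭-refl) (↭-prep z (↭-swap w x ↭-refl))))
              (head lB ∷ ~-sym wx ∷ wy ∷ tail (tail lB))
        x-after-z A B2 S lA lB | A′ ∷ʳ′ p with N[w] p (~-sym (linked-last A′ lA))
        ... | inj₁ refl = Distinct.A∩B S (∈-middle A′) (here refl)
        x-after-z A [] S lA lB | A′ ∷ʳ′ p | inj₂ refl =
          not-hamiltonian-↭ S (A′ ++ p ∷ w ∷ x ∷ z ∷ [])
            (subst (A′ ++ p ∷ w ∷ x ∷ z ∷ [] ↭_) (sym (++-assoc A′ [ p ] (w ∷ z ∷ x ∷ [])))
              (++⁺ˡ A′ (↭-prep p (↭-prep w (↭-swap x z ↭-refl)))))
            (linked-join A′ (linked-init A′ (subst (Linked _~_) (++-assoc A′ [ p ] [ w ]) lA)) (~-sym wy ∷ wx ∷ xz ∷ [-]))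
        x-after-z A (d ∷ B3) S lA lB | A′ ∷ʳ′ p | inj₂ refl with N[x] d (head (tail lB))
        ... | inj₁ refl = Distinct.u∉B S (there (here refl))
        ... | inj₂ (inj₂ refl) = Distinct.v∉B S (there (here refl))
        ... | inj₂ (inj₁ refl) = Distinct.A∩B S (∈-middle A′) (there (here refl))

        x-in-B : ∀ A B1 B2 → NoPath A (B1 ++ x ∷ B2)
        x-in-B A B1 B2 S lA lB with initLast B1
        ... | [] = x-after-z A B2 S lA lB
        ... | B1′ ∷ʳ′ p with N[x] p (~-sym (linked-last (z ∷ B1′) lB))
        ...   | inj₁ refl = Distinct.u∉B S (∈-last B1′ (x ∷ B2))
        ...   | inj₂ (inj₂ refl) = Distinct.v∉B S (∈-last B1′ (x ∷ B2))
        ...   | inj₂ (inj₁ refl) = y-before-x A B2 S lA lB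
          where
          y-before-x : ∀ A B2 → NoPath A ((B1′ ++ [ y ]) ++ x ∷ B2)
          y-before-x A (d ∷ B3) S lA lB with N[x] d (head (linked-from (z ∷ B1′ ++ [ y ]) lB))
          ... | inj₁ refl = Distinct.u∉B S (∈-++⁺ʳ (B1′ ++ [ y ]) (there (here refl)))
          ... | inj₂ (inj₂ refl) = Distinct.v∉B S (∈-++⁺ʳ (B1′ ++ [ y ]) (there (here refl)))
          ... | inj₂ (inj₁ refl) =
            unique-disjoint (B1′ ++ [ y ]) (unique-++ʳ (A ++ w ∷ z ∷ []) (subst Unique (sym (++-assoc A (w ∷ z ∷ []) _)) (unique S)))
                                     (∈-middle B1′) (there (here refl))
          y-before-x A [] S lA lB with initLast A
          ... | A′ ∷ʳ′ q with N[w] q (~-sym (linked-last A′ lA))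
          ...   | inj₁ refl = Distinct.A∩B S (∈-middle A′) (∈-++⁺ʳ (B1′ ++ [ y ]) (here refl))
          ...   | inj₂ refl = Distinct.A∩B S (∈-middle A′) (∈-last B1′ (x ∷ []))
          y-before-x A [] S lA lB | [] =
            not-hamiltonian-↭ S ((z ∷ B1′) ++ y ∷ w ∷ x ∷ [])
              perm
              (linked-join (z ∷ B1′) (linked-init (z ∷ B1′) (subst (Linked _~_) (cong (z ∷_) (++-assoc B1′ [ y ] [ x ])) lB))
                 (~-sym wy ∷ wx ∷ [-]))
            where
            perm : (z ∷ B1′) ++ y ∷ w ∷ x ∷ [] ↭ w ∷ z ∷ (B1′ ++ [ y ]) ++ x ∷ []
            perm = subst (λ L → z ∷ L ↭ w ∷ z ∷ (B1′ ++ [ y ]) ++ x ∷ []) (++-assoc B1′ [ y ] (w ∷ x ∷ []))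
                     (shift w (z ∷ B1′ ++ [ y ]) [ x ])

        x-in-A : ∀ A1 A2 B → NoPath (A1 ++ x ∷ A2) B
        x-in-A A1 [] B S lA lB with initLast A1
        ... | [] = not-hamiltonian-↭ S (w ∷ x ∷ z ∷ B) (↭-swap w x ↭-refl) (wx ∷ xz ∷ lB)
        ... | A1′ ∷ʳ′ p with N[x] p (~-sym (linked-last A1′ (subst (Linked _~_) (++-assoc (A1′ ++ [ p ]) [ x ] [ w ]) lA)))
        ...   | inj₁ refl = Distinct.u∉A S (∈-last A1′ [ x ])
        ...   | inj₂ (inj₂ refl) = Distinct.v∉A S (∈-last A1′ [ x ])
        ...   | inj₂ (inj₁ refl) =
          not-hamiltonian-↭ S (A1′ ++ y ∷ w ∷ x ∷ z ∷ B)
            (subst (A1′ ++ y ∷ w ∷ x ∷ z ∷ B ↭_) (sym (eq (w ∷ z ∷ B)))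
              (++⁺ˡ A1′ (↭-prep y (↭-swap w x ↭-refl))))
            (linked-join A1′ (linked-init A1′ (subst (Linked _~_) (eq [ w ]) lA))
              (~-sym wy ∷ wx ∷ xz ∷ lB))
          where
          eq : ∀ L → ((A1′ ++ [ y ]) ++ [ x ]) ++ L ≡ A1′ ++ y ∷ x ∷ L
          eq L = trans (++-assoc (A1′ ++ [ y ]) [ x ] L) (++-assoc A1′ [ y ] (x ∷ L))
        x-in-A A1 (d ∷ A2′) B S lA lB
          with N[x] d (head (linked-from A1 (subst (Linked _~_) (++-assoc A1 (x ∷ d ∷ A2′) [ w ]) lA)))
        ... | inj₁ refl = Distinct.u∉A S (∈-++⁺ʳ A1 (there (here refl)))
        ... | inj₂ (inj₂ refl) = Distinct.v∉A S (∈-++⁺ʳ A1 (there (here refl)))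
        ... | inj₂ (inj₁ refl) with initLast A1
        ...   | A1′ ∷ʳ′ p
          with N[x] p (~-sym (linked-last A1′ (linked-init (A1′ ++ [ p ])
                 (subst (Linked _~_) (++-assoc (A1′ ++ [ p ]) (x ∷ d ∷ A2′) [ w ]) lA))))
        ...     | inj₁ refl = Distinct.u∉A S (∈-last A1′ (x ∷ d ∷ A2′))
        ...     | inj₂ (inj₂ refl) = Distinct.v∉A S (∈-last A1′ (x ∷ d ∷ A2′))
        ...     | inj₂ (inj₁ refl) = unique-disjoint (A1′ ++ [ p ]) (unique-++ˡ ((A1′ ++ [ p ]) ++ x ∷ p ∷ A2′) (unique S))
                                       (∈-middle A1′) (there (here refl))
        x-in-A A1 (d ∷ A2′) B S lA lB | inj₂ (inj₁ refl) | [] with initLast A2′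
        ...     | [] = not-hamiltonian-↭ S (y ∷ w ∷ x ∷ z ∷ B)
                     (↭-sym (↭-trans (↭-swap x y ↭-refl) (↭-prep y (↭-swap x w ↭-refl))))
                     (~-sym wy ∷ wx ∷ xz ∷ lB)
        ...     | A2″ ∷ʳ′ q with N[w] q (~-sym (linked-last (x ∷ y ∷ A2″) lA))
        ...       | inj₁ refl = Unique[x∷xs]⇒x∉xs (unique-++ˡ (x ∷ y ∷ A2″ ++ [ q ]) (unique S)) (there (∈-middle A2″))
        ...       | inj₂ refl = Unique[x∷xs]⇒x∉xs (unique-tail (unique-++ˡ (x ∷ y ∷ A2″ ++ [ q ]) (unique S))) (∈-middle A2″)

      impossible : w ≢ z → z ≢ y → ⊥
      impossible w≢z z≢y with adj G w z in wz
      ... | true with N[w] z wz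
      ...   | inj₁ refl = ~-irrefl xz refl
      ...   | inj₂ refl = z≢y refl
      impossible w≢z z≢y | false with pathVia w z w≢z wz
      ... | via A B S lA lB with locate A B x (covers S x)
      ...   | inj₂ (inj₁ refl) = ~-irrefl wx refl
      ...   | inj₂ (inj₂ (inj₁ refl)) = ~-irrefl xz refl
      ...   | inj₁ x∈A with ∈-∃++ x∈A
      ...     | A1 , A2 , refl = x-in-A A1 A2 B S lA lB
      impossible w≢z z≢y | false | via A B S lA lB | inj₂ (inj₂ (inj₂ x∈B)) with ∈-∃++ x∈B
      ...     | B1 , B2 , refl = x-in-B A B1 B2 S lA lB

    module TwoDeg2Nbrs {x w₁ w₂ y z : V} (w₁x : w₁ ~ x) (w₁y : w₁ ~ y) (N[w₁] : OnlyNbrs w₁ x y)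
                       (w₂x : w₂ ~ x) (w₂z : w₂ ~ z) (N[w₂] : OnlyNbrs w₂ x z) (xz : x ~ z)
                       (N[x] : OnlyNbrs₄ x y z w₁ w₂) where

      private
        NoPath : List V → List V → Set
        NoPath A B = Spanning (A ++ w₁ ∷ z ∷ B) → Linked _~_ (A ++ [ w₁ ]) → Linked _~_ (z ∷ B) → ⊥

        B-is-w₂ : ∀ A → NoPath A (w₂ ∷ [])
        B-is-w₂ A S lA lB with locate A (w₂ ∷ []) x (covers S x)
        ... | inj₂ (inj₁ refl) = ~-irrefl w₁x refl
        ... | inj₂ (inj₂ (inj₁ refl)) = ~-irrefl xz refl
        ... | inj₂ (inj₂ (inj₂ (here refl))) = ~-irrefl w₂x refl
        ... | inj₁ m with ∈-∃++ m
        ... | A1 , [] , refl with initLast A1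
        ...   | [] = too-short n≥6 S
        ...   | A1′ ∷ʳ′ p with N[x] p (~-sym (linked-last A1′ (subst (Linked _~_) (++-assoc (A1′ ++ [ p ]) [ x ] [ w₁ ]) lA)))
        ...     | inj₂ (inj₁ refl) = Distinct.v∉A S (∈-last A1′ [ x ])
        ...     | inj₂ (inj₂ (inj₁ refl)) = Distinct.u∉A S (∈-last A1′ [ x ])
        ...     | inj₂ (inj₂ (inj₂ refl)) = Distinct.A∩B S (∈-last A1′ [ x ]) (here refl)
        ...     | inj₁ refl = not-hamiltonian-↭ S (A1′ ++ y ∷ w₁ ∷ x ∷ w₂ ∷ z ∷ [])
                  (subst (A1′ ++ y ∷ w₁ ∷ x ∷ w₂ ∷ z ∷ [] ↭_) (sym (eq (w₁ ∷ z ∷ w₂ ∷ [])))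
                    (++⁺ˡ A1′ (↭-prep y (↭-trans (↭-swap w₁ x ↭-refl) (↭-prep x (↭-prep w₁ (↭-swap w₂ z ↭-refl)))))))
                  (linked-join A1′ (linked-init A1′ (subst (Linked _~_) (eq [ w₁ ]) lA))
                     (~-sym w₁y ∷ w₁x ∷ ~-sym w₂x ∷ w₂z ∷ [-]))
          where
          eq : ∀ L → ((A1′ ++ [ y ]) ++ [ x ]) ++ L ≡ A1′ ++ y ∷ x ∷ L
          eq L = trans (++-assoc (A1′ ++ [ y ]) [ x ] L) (++-assoc A1′ [ y ] (x ∷ L))
        B-is-w₂ A S lA lB | inj₁ m | A1 , d ∷ A2′ , refl
          with N[x] d (head (linked-from A1 (subst (Linked _~_) (++-assoc A1 (x ∷ d ∷ A2′) [ w₁ ]) lA)))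
        ... | inj₂ (inj₁ refl) = Distinct.v∉A S (∈-++⁺ʳ A1 (there (here refl)))
        ... | inj₂ (inj₂ (inj₁ refl)) = Distinct.u∉A S (∈-++⁺ʳ A1 (there (here refl)))
        ... | inj₂ (inj₂ (inj₂ refl)) = Distinct.A∩B S (∈-++⁺ʳ A1 (there (here refl))) (here refl)
        ... | inj₁ refl with initLast A2′
        ...   | A2″ ∷ʳ′ q
          with N[w₁] q (~-sym (linked-last (A1 ++ x ∷ y ∷ A2″)
                 (subst (Linked _~_) (cong (_++ [ w₁ ]) (sym (++-assoc A1 (x ∷ y ∷ A2″) [ q ]))) lA)))
        ...     | inj₁ refl =
          Unique[x∷xs]⇒x∉xs (unique-++ʳ A1 (unique-++ˡ (A1 ++ x ∷ y ∷ A2″ ++ [ q ]) (unique S))) (there (∈-middle A2″))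
        ...     | inj₂ refl =
          Unique[x∷xs]⇒x∉xs (unique-tail (unique-++ʳ A1 (unique-++ˡ (A1 ++ x ∷ y ∷ A2″ ++ [ q ]) (unique S)))) (∈-middle A2″)
        B-is-w₂ A S lA lB | inj₁ m | A1 , d ∷ A2′ , refl | inj₁ refl | [] with initLast A1
        ...     | [] = too-short n≥6 S
        ...     | A1′ ∷ʳ′ p
          with N[x] p (~-sym (linked-last A1′ (subst (Linked _~_) (++-assoc (A1′ ++ [ p ]) (x ∷ y ∷ []) [ w₁ ]) lA)))
        ...       | inj₁ refl =
          unique-disjoint (A1′ ++ [ p ]) (unique-++ˡ ((A1′ ++ [ p ]) ++ x ∷ p ∷ []) (unique S)) (∈-middle A1′) (there (here refl))
        ...       | inj₂ (inj₁ refl) = Distinct.v∉A S (∈-last A1′ (x ∷ y ∷ []))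
        ...       | inj₂ (inj₂ (inj₁ refl)) = Distinct.u∉A S (∈-last A1′ (x ∷ y ∷ []))
        ...       | inj₂ (inj₂ (inj₂ refl)) = Distinct.A∩B S (∈-last A1′ (x ∷ y ∷ [])) (here refl)

        B-from-w₂x : ∀ A B3 → NoPath A (w₂ ∷ x ∷ B3)
        B-from-w₂x A B3 S lA lB with initLast A
        B-from-w₂x A [] S lA lB | [] = too-short n≥6 S
        B-from-w₂x A (d ∷ B4) S lA lB | [] with N[x] d (head (tail (tail lB)))
        ... | inj₂ (inj₁ refl) = Distinct.v∉B {A = []} S (there (there (here refl)))
        ... | inj₂ (inj₂ (inj₁ refl)) = Distinct.u∉B {A = []} S (there (there (here refl)))
        ... | inj₂ (inj₂ (inj₂ refl)) = Unique[x∷xs]⇒x∉xs (unique-tail (unique-tail (unique S))) (there (here refl))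
        ... | inj₁ refl = not-hamiltonian-↭ S (z ∷ w₂ ∷ x ∷ w₁ ∷ d ∷ B4)
              (shift w₁ (z ∷ w₂ ∷ x ∷ []) (d ∷ B4))
              (~-sym w₂z ∷ w₂x ∷ ~-sym w₁x ∷ w₁y ∷ tail (tail (tail lB)))
        B-from-w₂x A B3 S lA lB | A′ ∷ʳ′ p with N[w₁] p (~-sym (linked-last A′ lA))
        ... | inj₁ refl = Distinct.A∩B S (∈-middle A′) (there (here refl))
        B-from-w₂x A [] S lA lB | A′ ∷ʳ′ p | inj₂ refl =
          not-hamiltonian-↭ S (A′ ++ y ∷ w₁ ∷ x ∷ w₂ ∷ z ∷ [])
            (subst (A′ ++ y ∷ w₁ ∷ x ∷ w₂ ∷ z ∷ [] ↭_) (sym (++-assoc A′ [ y ] (w₁ ∷ z ∷ w₂ ∷ x ∷ [])))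
              (++⁺ˡ A′ (↭-prep y (↭-prep w₁ (↭-trans (↭-swap x w₂ ↭-refl)
                 (↭-trans (↭-prep w₂ (↭-swap x z ↭-refl)) (↭-swap w₂ z ↭-refl)))))))
            (linked-join A′ (linked-init A′ (subst (Linked _~_) (++-assoc A′ [ y ] [ w₁ ]) lA))
               (~-sym w₁y ∷ w₁x ∷ ~-sym w₂x ∷ w₂z ∷ [-]))
        B-from-w₂x A (d ∷ B4) S lA lB | A′ ∷ʳ′ p | inj₂ refl with N[x] d (head (tail (tail lB)))
        ... | inj₁ refl = Distinct.A∩B S (∈-middle A′) (there (there (here refl)))
        ... | inj₂ (inj₁ refl) = Distinct.v∉B S (there (there (here refl)))
        ... | inj₂ (inj₂ (inj₁ refl)) = Distinct.u∉B S (there (there (here refl)))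
        ... | inj₂ (inj₂ (inj₂ refl)) = Unique[x∷xs]⇒x∉xs (Distinct.unique-B S) (there (here refl))

        B-ends-xw₂ : ∀ A B1′ → NoPath A ((B1′ ++ [ x ]) ++ w₂ ∷ [])
        B-ends-xw₂ A B1′ S lA lB with initLast B1′
        ... | [] = not-hamiltonian-↭ S (A ++ w₁ ∷ x ∷ w₂ ∷ z ∷ [])
              (++⁺ˡ A (↭-prep w₁ (shift z (x ∷ w₂ ∷ []) [])))
              (linked-join A lA (w₁x ∷ ~-sym w₂x ∷ w₂z ∷ [-]))
        ... | B1″ ∷ʳ′ q
          with N[x] q (~-sym (linked-last (z ∷ B1″) (subst (Linked _~_) (cong (z ∷_) (++-assoc (B1″ ++ [ q ]) [ x ] [ w₂ ])) lB)))
        ...   | inj₂ (inj₁ refl) = Distinct.v∉B S (∈-++⁺ˡ (∈-last B1″ [ x ]))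
        ...   | inj₂ (inj₂ (inj₁ refl)) = Distinct.u∉B S (∈-++⁺ˡ (∈-last B1″ [ x ]))
        ...   | inj₂ (inj₂ (inj₂ refl)) =
          unique-disjoint ((B1″ ++ [ q ]) ++ [ x ]) (Distinct.unique-B S) (∈-++⁺ˡ (∈-middle B1″)) (here refl)
        ...   | inj₁ refl with initLast A
        ...     | A′ ∷ʳ′ p with N[w₁] p (~-sym (linked-last A′ lA))
        ...       | inj₁ refl = Distinct.A∩B S (∈-middle A′) (∈-++⁺ˡ (∈-middle (B1″ ++ [ q ])))
        ...       | inj₂ refl = Distinct.A∩B S (∈-middle A′) (∈-++⁺ˡ (∈-last B1″ [ x ]))
        B-ends-xw₂ A B1′ S lA lB | B1″ ∷ʳ′ q | inj₁ refl | [] =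
          not-hamiltonian-↭ S (z ∷ B1″ ++ y ∷ w₁ ∷ x ∷ w₂ ∷ [])
            perm
            (linked-join (z ∷ B1″) (linked-init (z ∷ B1″) (subst (Linked _~_) (cong (z ∷_) eq) lB))
               (~-sym w₁y ∷ w₁x ∷ ~-sym w₂x ∷ [-]))
          where
          eq : ((B1″ ++ [ y ]) ++ [ x ]) ++ w₂ ∷ [] ≡ B1″ ++ y ∷ x ∷ w₂ ∷ []
          eq = trans (++-assoc (B1″ ++ [ y ]) [ x ] [ w₂ ]) (++-assoc B1″ [ y ] (x ∷ w₂ ∷ []))
          perm : z ∷ B1″ ++ y ∷ w₁ ∷ x ∷ w₂ ∷ [] ↭ w₁ ∷ z ∷ ((B1″ ++ [ y ]) ++ [ x ]) ++ w₂ ∷ []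
          perm = subst₂ (λ L M → z ∷ L ↭ w₁ ∷ z ∷ M) (++-assoc B1″ [ y ] (w₁ ∷ x ∷ w₂ ∷ []))
                   (trans (++-assoc B1″ [ y ] (x ∷ w₂ ∷ [])) (sym eq))
                   (shift w₁ (z ∷ B1″ ++ [ y ]) (x ∷ w₂ ∷ []))

        w₂-in-A : ∀ A1 A2 B → w₁ ≢ z → NoPath (A1 ++ w₂ ∷ A2) B
        w₂-in-A A1 [] B w₁≢z S lA lB with N[w₂] w₁ (head (linked-from A1 (subst (Linked _~_) (++-assoc A1 [ w₂ ] [ w₁ ]) lA)))
        ... | inj₁ refl = ~-irrefl w₁x refl
        ... | inj₂ refl = w₁≢z refl
        w₂-in-A A1 (d ∷ A2′) B w₁≢z S lA lB
          with N[w₂] d (head (linked-from A1 (subst (Linked _~_) (++-assoc A1 (w₂ ∷ d ∷ A2′) [ w₁ ]) lA)))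
        ... | inj₂ refl = Distinct.v∉A S (∈-++⁺ʳ A1 (there (here refl)))
        ... | inj₁ refl with initLast A1
        ...   | A1′ ∷ʳ′ p
          with N[w₂] p (~-sym (linked-last A1′ (linked-init (A1′ ++ [ p ])
                 (subst (Linked _~_) (++-assoc (A1′ ++ [ p ]) (w₂ ∷ d ∷ A2′) [ w₁ ]) lA))))
        ...     | inj₁ refl =
          unique-disjoint (A1′ ++ [ p ]) (unique-++ˡ ((A1′ ++ [ p ]) ++ w₂ ∷ p ∷ A2′) (unique S)) (∈-middle A1′) (there (here refl))
        ...     | inj₂ refl = Distinct.v∉A S (∈-last A1′ (w₂ ∷ d ∷ A2′))
        w₂-in-A A1 (d ∷ []) B w₁≢z S lA lB | inj₁ refl | [] =
          not-hamiltonian-↭ S (w₁ ∷ x ∷ w₂ ∷ z ∷ B)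
            (↭-sym (↭-trans (↭-swap w₂ x ↭-refl) (↭-trans (↭-prep x (↭-swap w₂ w₁ ↭-refl)) (↭-swap x w₁ ↭-refl))))
            (w₁x ∷ ~-sym w₂x ∷ w₂z ∷ lB)
        w₂-in-A A1 (d ∷ e ∷ A3) B w₁≢z S lA lB | inj₁ refl | [] with N[x] e (head (tail lA))
        ... | inj₂ (inj₁ refl) = Distinct.v∉A S (there (there (here refl)))
        ... | inj₂ (inj₂ (inj₁ refl)) = Distinct.u∉A S (there (there (here refl)))
        ... | inj₂ (inj₂ (inj₂ refl)) = Unique[x∷xs]⇒x∉xs (unique-++ˡ (w₂ ∷ x ∷ e ∷ A3) (unique S)) (there (here refl))
        ... | inj₁ refl with initLast A3
        ...   | [] = not-hamiltonian-↭ S (y ∷ w₁ ∷ x ∷ w₂ ∷ z ∷ B)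
                   (↭-trans (shifts (y ∷ w₁ ∷ []) (x ∷ w₂ ∷ [])) (↭-swap x w₂ ↭-refl))
                   (~-sym w₁y ∷ w₁x ∷ ~-sym w₂x ∷ w₂z ∷ lB)
        ...   | A3′ ∷ʳ′ q with N[w₁] q (~-sym (linked-last (w₂ ∷ x ∷ y ∷ A3′) lA))
        ...     | inj₁ refl =
          Unique[x∷xs]⇒x∉xs (unique-tail (unique-++ˡ (w₂ ∷ x ∷ y ∷ A3′ ++ [ q ]) (unique S))) (there (∈-middle A3′))
        ...     | inj₂ refl =
          Unique[x∷xs]⇒x∉xs (unique-tail (unique-tail (unique-++ˡ (w₂ ∷ x ∷ y ∷ A3′ ++ [ q ]) (unique S)))) (∈-middle A3′)

      impossible : w₁ ≢ z → z ≢ y → ⊥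
      impossible w₁≢z z≢y with adj G w₁ z in w₁z
      ... | true with N[w₁] z w₁z
      ...   | inj₁ refl = ~-irrefl xz refl
      ...   | inj₂ refl = z≢y refl
      impossible w₁≢z z≢y | false with pathVia w₁ z w₁≢z w₁z
      ... | via A B S lA lB with locate A B w₂ (covers S w₂)
      ...   | inj₂ (inj₁ refl) with N[w₁] z w₂z
      ...     | inj₁ refl = ~-irrefl xz refl
      ...     | inj₂ refl = z≢y refl
      impossible w₁≢z z≢y | false | via A B S lA lB | inj₂ (inj₂ (inj₁ refl)) = ~-irrefl w₂z refl
      impossible w₁≢z z≢y | false | via A B S lA lB | inj₁ w₂∈A with ∈-∃++ w₂∈A
      ...   | A1 , A2 , refl = w₂-in-A A1 A2 B w₁≢z S lA lB
      impossible w₁≢z z≢y | false | via A B S lA lB | inj₂ (inj₂ (inj₂ w₂∈B)) with ∈-∃++ w₂∈B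
      ...   | B1 , B2 , refl with initLast B1
      impossible w₁≢z z≢y | false | via A B S lA lB | inj₂ (inj₂ (inj₂ w₂∈B))
        | B1 , [] , refl | [] = B-is-w₂ A S lA lB
      impossible w₁≢z z≢y | false | via A B S lA lB | inj₂ (inj₂ (inj₂ w₂∈B))
        | B1 , d ∷ B3 , refl | [] with N[w₂] d (head (tail lB))
      ...   | inj₂ refl = Distinct.v∉B S (there (here refl))
      ...   | inj₁ refl = B-from-w₂x A B3 S lA lB
      impossible w₁≢z z≢y | false | via A B S lA lB | inj₂ (inj₂ (inj₂ w₂∈B))
        | B1 , B2 , refl | B1′ ∷ʳ′ p with N[w₂] p (~-sym (linked-last (z ∷ B1′) lB))
      ...   | inj₂ refl = Distinct.v∉B S (∈-last B1′ (w₂ ∷ B2))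
      impossible w₁≢z z≢y | false | via A B S lA lB | inj₂ (inj₂ (inj₂ w₂∈B))
        | B1 , [] , refl | B1′ ∷ʳ′ p | inj₁ refl = B-ends-xw₂ A B1′ S lA lB
      impossible w₁≢z z≢y | false | via A B S lA lB | inj₂ (inj₂ (inj₂ w₂∈B))
        | B1 , d ∷ B3 , refl | B1′ ∷ʳ′ p | inj₁ refl with N[w₂] d (head (linked-from (z ∷ B1′ ++ [ p ]) lB))
      ...   | inj₂ refl = Distinct.v∉B S (∈-++⁺ʳ (B1′ ++ [ p ]) (there (here refl)))
      ...   | inj₁ refl = unique-disjoint (B1′ ++ [ p ]) (Distinct.unique-B S) (∈-middle B1′) (there (here refl))

  twins-bound : ∀ {x s p q} {Ts : List V} → Unique Ts →
                (∀ {t} → t ∈ Ts → t ~ x × t ~ s × OnlyNbrs t x s) →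
                p ≢ q → adj G p q ≡ false → p ∉ Ts → q ∉ Ts → p ≢ x → p ≢ s → length Ts ≤ 2
  twins-bound {x} {s} {p} {q} {Ts} uTs twin p≢q pq p∉Ts q∉Ts p≢x p≢s =
    scattering-bound (unique S) uTs (λ {t} _ → covers S t) (covers S p) p∉Ts p∉Ss Ts∩Ss≡∅
      (Linked.map separated (PathVia-linked P))
    where
    open Scattering _≟_
    P = pathVia p q p≢q pq
    S = PathVia.spanning P
    Ss = x ∷ s ∷ []
    p∉Ss : p ∉ Ss
    p∉Ss (here p≡x) = p≢x p≡x
    p∉Ss (there (here p≡s)) = p≢s p≡s
    Ts∩Ss≡∅ : ∀ {c} → c ∈ Ts → c ∉ Ss
    Ts∩Ss≡∅ c∈Ts (here refl) = ~-irrefl (proj₁ (twin c∈Ts)) refl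
    Ts∩Ss≡∅ c∈Ts (there (here refl)) = ~-irrefl (proj₁ (proj₂ (twin c∈Ts))) refl
    nbr∈Ss : ∀ {c d} → c ∈ Ts → AdjPlus p q c d → d ∈ Ss
    nbr∈Ss c∈Ts (inj₁ cd) with proj₂ (proj₂ (twin c∈Ts)) _ cd
    ... | inj₁ refl = here refl
    ... | inj₂ refl = there (here refl)
    nbr∈Ss c∈Ts (inj₂ (inj₁ (refl , _))) = ⊥-elim (p∉Ts c∈Ts)
    nbr∈Ss c∈Ts (inj₂ (inj₂ (refl , _))) = ⊥-elim (q∉Ts c∈Ts)
    separated : ∀ {c d} → AdjPlus p q c d → Separated (λ c → does (c ∈? Ts)) (λ c → does (c ∈? Ss)) c d
    separated {c} {d} cd =
      (λ c∈Ts → dec-true (d ∈? Ss) (nbr∈Ss (does⇒ (c ∈? Ts) c∈Ts) cd)) ,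
      (λ d∈Ts → dec-true (c ∈? Ss) (nbr∈Ss (does⇒ (d ∈? Ts) d∈Ts) (AdjPlus-sym cd)))

  -- The bound d₃ x ≥ 3

  module _ (n≥7 : 7 ≤ n) (connected : Connected G) (no-deg1 : ∀ v → ¬ degree G v ≡ 1)
           (no-adjacent-deg2 : ∀ u v → u ~ v → ¬ (degree G u ≡ 2 × degree G v ≡ 2)) where

    open Degree2Nbrs G

    n≥6 : 6 ≤ n
    n≥6 = ≤-trans (n≤1+n 6) n≥7

    deg : V → ℕ
    deg = degree G

    deg2≢ : ∀ {a b} → deg a ≡ 2 → deg b ≢ 2 → a ≢ b
    deg2≢ a2 b≢2 refl = b≢2 a2

    deg2Nbr? highNbr? : V → V → Bool
    deg2Nbr? x c = adj G x c ∧ deg2? c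
    highNbr? x c = adj G x c ∧ not (deg2? c)

    another-vertex : (L : List V) → length L < n → ∃ λ v → v ∉ L
    another-vertex L L<n with fresh (λ _ → true) L (subst (length L <_) (sym count-true) L<n)
    ... | v , _ , v∉L = v , v∉L

    degree≥3 : ∀ x → deg x ≢ 2 → 3 ≤ deg x
    degree≥3 x x≢2 with another-vertex [ x ] (≤-trans (s≤s (s≤s z≤n)) n≥7)
    ... | v , v∉[x] with connected x v
    ... | here = ⊥-elim (v∉[x] (here refl))
    ... | step {w = w} xw _ = ≥3 (deg x) (count-remove (adj G x) w xw) (no-deg1 x) x≢2
      where
      ≥3 : ∀ d {m} → d ≡ suc m → d ≢ 1 → d ≢ 2 → 3 ≤ d
      ≥3 1 _ d≢1 _ = ⊥-elim (d≢1 refl)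
      ≥3 2 _ _ d≢2 = ⊥-elim (d≢2 refl)
      ≥3 (suc (suc (suc d))) _ _ _ = s≤s (s≤s (s≤s z≤n))

    deg2-nbrs : ∀ {w} → deg w ≡ 2 → ∃₂ λ a b → a ≢ b × w ~ a × w ~ b × OnlyNbrs w a b
    deg2-nbrs {w} w2 with pick (adj G w) 2 (≤-reflexive (sym w2))
    ... | a ∷ b ∷ [] , refl , u@((a≢b ∷ []) ∷ _) , wa ∷ wb ∷ [] = a , b , a≢b , wa , wb , only
      where
      only : OnlyNbrs w a b
      only c wc with count≤length⇒∈ (adj G w) u (wa ∷ wb ∷ []) (≤-reflexive w2) wc
      ... | here c≡a = inj₁ c≡a
      ... | there (here c≡b) = inj₂ c≡b

    record Deg2Nbr (x w h : V) : Set where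
      field
        w~x : w ~ x
        w~h : w ~ h
        onlyNbrs : OnlyNbrs w x h
        x~h : x ~ h
        deg-w≡2 : deg w ≡ 2
        deg-h≢2 : deg h ≢ 2

    open Deg2Nbr

    hub : ∀ {x w} → x ~ w → deg w ≡ 2 → ∃ (Deg2Nbr x w)
    hub {x} {w} xw w2 with deg2-nbrs w2
    ... | a , b , a≢b , wa , wb , N with N x (~-sym xw)
    ...   | inj₁ refl = b , record
      { w~x = wa ; w~h = wb ; onlyNbrs = N ; x~h = deg2-nbrs-adjacent a≢b wa wb N
      ; deg-w≡2 = w2 ; deg-h≢2 = λ b2 → no-adjacent-deg2 w b wb (w2 , b2) }
    ...   | inj₂ refl = a , record
      { w~x = wb ; w~h = wa ; onlyNbrs = OnlyNbrs-swap N ; x~h = deg2-nbrs-adjacent (≢-sym a≢b) wb wa (OnlyNbrs-swap N)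
      ; deg-w≡2 = w2 ; deg-h≢2 = λ a2 → no-adjacent-deg2 w a wa (w2 , a2) }

    no-three-common-hub : ∀ {x s h t₁ t₂ t₃ t₄} → t₁ ≢ t₂ → t₁ ≢ t₃ → t₂ ≢ t₃ → t₁ ≢ t₄ → t₂ ≢ t₄ → t₃ ≢ t₄ →
                          Deg2Nbr x t₁ s → Deg2Nbr x t₂ s → Deg2Nbr x t₃ s → Deg2Nbr x t₄ h → ⊥
    no-three-common-hub {x} {s} {h} {t₁} {t₂} {t₃} {t₄} t₁≢t₂ t₁≢t₃ t₂≢t₃ t₁≢t₄ t₂≢t₄ t₃≢t₄ D₁ D₂ D₃ D₄ =
      by-hub (h ≟ s)
      where
      Ts = t₁ ∷ t₂ ∷ t₃ ∷ []
      D : ∀ {t} → t ∈ Ts → Deg2Nbr x t s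
      D (here refl) = D₁
      D (there (here refl)) = D₂
      D (there (there (here refl))) = D₃
      t₄∉Ts : t₄ ∉ Ts
      t₄∉Ts (here t₄≡t₁) = t₁≢t₄ (sym t₄≡t₁)
      t₄∉Ts (there (here t₄≡t₂)) = t₂≢t₄ (sym t₄≡t₂)
      t₄∉Ts (there (there (here t₄≡t₃))) = t₃≢t₄ (sym t₄≡t₃)
      three-twins-avoiding : ∀ {q} → t₄ ≢ q → adj G t₄ q ≡ false → q ∉ Ts → ⊥
      three-twins-avoiding t₄≢q t₄q q∉Ts with twins-bound ((t₁≢t₂ ∷ t₁≢t₃ ∷ []) ∷ (t₂≢t₃ ∷ []) ∷ [] ∷ [])
        (λ t∈Ts → w~x (D t∈Ts) , w~h (D t∈Ts) , onlyNbrs (D t∈Ts))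
        t₄≢q t₄q t₄∉Ts q∉Ts (~-irrefl (w~x D₄)) (deg2≢ (deg-w≡2 D₄) (deg-h≢2 D₁))
      ... | s≤s (s≤s ())
      by-hub : Dec (h ≡ s) → ⊥
      by-hub (yes refl) with another-vertex (x ∷ s ∷ t₁ ∷ t₂ ∷ t₃ ∷ t₄ ∷ []) n≥7
      ... | v , v∉ = three-twins-avoiding (λ t₄≡v → v∉ (there (there (there (there (there (here (sym t₄≡v))))))))
                       (≁⇒false t₄≁v) (v∉ ∘ there ∘ there ∘ ∈-++⁺ˡ)
        where
        t₄≁v : ¬ t₄ ~ v
        t₄≁v t₄v with onlyNbrs D₄ v t₄v
        ... | inj₁ v≡x = v∉ (here v≡x)
        ... | inj₂ v≡s = v∉ (there (here v≡s))
      by-hub (no h≢s) = three-twins-avoiding (deg2≢ (deg-w≡2 D₄) (deg-h≢2 D₁)) (≁⇒false t₄≁s)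
                          (λ s∈Ts → deg-h≢2 (D s∈Ts) (deg-w≡2 (D s∈Ts)))
        where
        t₄≁s : ¬ t₄ ~ s
        t₄≁s t₄s with onlyNbrs D₄ s t₄s
        ... | inj₁ s≡x = ~-irrefl (x~h D₁) (sym s≡x)
        ... | inj₂ s≡h = h≢s (sym s≡h)

    Universal : V → Set
    Universal x = ∀ c → c ≢ x → x ~ c

    HighNbrsIn : V → V → V → Set
    HighNbrsIn x y z = ∀ c → x ~ c → deg c ≢ 2 → c ≡ y ⊎ c ≡ z

    -- For n = 7 the named vertices form the Hamiltonian path p₁ y p₂ x q₁ z q₂; otherwise an
    -- eighth vertex is a degree-2 neighbour of x whose hub is y or z.
    no-two-twin-pairs : ∀ {x y z p₁ p₂ q₁ q₂} → Universal x → y ≢ z → HighNbrsIn x y z →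
                        p₁ ≢ p₂ → p₁ ≢ q₁ → p₁ ≢ q₂ → p₂ ≢ q₁ → p₂ ≢ q₂ → q₁ ≢ q₂ →
                        Deg2Nbr x p₁ y → Deg2Nbr x p₂ y → Deg2Nbr x q₁ z → Deg2Nbr x q₂ z → ⊥
    no-two-twin-pairs {x} {y} {z} {p₁} {p₂} {q₁} {q₂} universal y≢z high
                      p₁≢p₂ p₁≢q₁ p₁≢q₂ p₂≢q₁ p₂≢q₂ q₁≢q₂ P₁ P₂ Q₁ Q₂ with 8 ≤? n
    ... | no n≱8 = not-hamiltonian S (w~h P₁ ∷ ~-sym (w~h P₂) ∷ w~x P₂ ∷ ~-sym (w~x Q₁) ∷ w~h Q₁ ∷ ~-sym (w~h Q₂) ∷ [-])
      where
      S : Spanning (p₁ ∷ y ∷ p₂ ∷ x ∷ q₁ ∷ z ∷ q₂ ∷ [])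
      S = record
        { unique =
            (deg2≢ (deg-w≡2 P₁) (deg-h≢2 P₁) ∷ p₁≢p₂ ∷ ~-irrefl (w~x P₁) ∷ p₁≢q₁ ∷ deg2≢ (deg-w≡2 P₁) (deg-h≢2 Q₁) ∷ p₁≢q₂ ∷ []) ∷
            (≢-sym (deg2≢ (deg-w≡2 P₂) (deg-h≢2 P₁)) ∷ ≢-sym (~-irrefl (x~h P₁)) ∷ ≢-sym (deg2≢ (deg-w≡2 Q₁) (deg-h≢2 P₁)) ∷
             y≢z ∷ ≢-sym (deg2≢ (deg-w≡2 Q₂) (deg-h≢2 P₁)) ∷ []) ∷
            (~-irrefl (w~x P₂) ∷ p₂≢q₁ ∷ deg2≢ (deg-w≡2 P₂) (deg-h≢2 Q₁) ∷ p₂≢q₂ ∷ []) ∷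
            (≢-sym (~-irrefl (w~x Q₁)) ∷ ~-irrefl (x~h Q₁) ∷ ≢-sym (~-irrefl (w~x Q₂)) ∷ []) ∷
            (deg2≢ (deg-w≡2 Q₁) (deg-h≢2 Q₁) ∷ q₁≢q₂ ∷ []) ∷
            (≢-sym (deg2≢ (deg-w≡2 Q₂) (deg-h≢2 Q₁)) ∷ []) ∷ [] ∷ []
        ; length≡n = ≤-antisym n≥7 (≤-pred (≰⇒> n≱8)) }
    ... | yes n≥8 with another-vertex (p₁ ∷ y ∷ p₂ ∷ x ∷ q₁ ∷ z ∷ q₂ ∷ []) n≥8
    ...   | u , u∉ with deg u ≟ℕ 2 | universal u (λ u≡x → u∉ (there (there (there (here u≡x)))))
    ...     | no u≢2 | xu with high u xu u≢2
    ...       | inj₁ u≡y = u∉ (there (here u≡y))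
    ...       | inj₂ u≡z = u∉ (there (there (there (there (there (here u≡z))))))
    no-two-twin-pairs {x} {y} {z} {p₁} {p₂} {q₁} {q₂} universal y≢z high
                      p₁≢p₂ p₁≢q₁ p₁≢q₂ p₂≢q₁ p₂≢q₂ q₁≢q₂ P₁ P₂ Q₁ Q₂ | yes n≥8 | u , u∉ | yes u2 | xu
      with hub xu u2
    ... | h , U with high h (x~h U) (deg-h≢2 U)
    ...   | inj₁ refl = no-three-common-hub p₁≢p₂ (λ p₁≡u → u∉ (here (sym p₁≡u)))
                          (λ p₂≡u → u∉ (there (there (here (sym p₂≡u))))) p₁≢q₁ p₂≢q₁
                          (λ u≡q₁ → u∉ (there (there (there (there (here u≡q₁)))))) P₁ P₂ U Q₁
    ...   | inj₂ refl = no-three-common-hub q₁≢q₂ (λ q₁≡u → u∉ (there (there (there (there (here (sym q₁≡u)))))))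
                          (λ q₂≡u → u∉ (there (there (there (there (there (there (here (sym q₂≡u))))))))) (≢-sym p₁≢q₁)
                          (≢-sym p₁≢q₂) (λ u≡p₁ → u∉ (here u≡p₁)) Q₁ Q₂ U P₁

    -- Pigeonhole: three of the hubs agree, or they split two and two.
    two-hubs-impossible : ∀ {x y z a₁ a₂ a₃ a₄ h₁ h₂ h₃ h₄} → Universal x → HighNbrsIn x y z →
                          a₁ ≢ a₂ → a₁ ≢ a₃ → a₁ ≢ a₄ → a₂ ≢ a₃ → a₂ ≢ a₄ → a₃ ≢ a₄ →
                          Deg2Nbr x a₁ h₁ → Deg2Nbr x a₂ h₂ → Deg2Nbr x a₃ h₃ → Deg2Nbr x a₄ h₄ →
                          h₁ ≡ y ⊎ h₁ ≡ z → h₂ ≡ y ⊎ h₂ ≡ z → h₃ ≡ y ⊎ h₃ ≡ z → h₄ ≡ y ⊎ h₄ ≡ z → ⊥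
    two-hubs-impossible {y = y} {z} u hi d₁₂ d₁₃ d₁₄ d₂₃ d₂₄ d₃₄ A₁ A₂ A₃ A₄ e₁ e₂ e₃ e₄ with y ≟ z
    ... | yes refl with reduce e₁ | reduce e₂ | reduce e₃
    ...   | refl | refl | refl = no-three-common-hub d₁₂ d₁₃ d₂₃ d₁₄ d₂₄ d₃₄ A₁ A₂ A₃ A₄
    two-hubs-impossible u hi d₁₂ d₁₃ d₁₄ d₂₃ d₂₄ d₃₄ A₁ A₂ A₃ A₄ e₁ e₂ e₃ e₄ | no y≢z with e₁ | e₂ | e₃ | e₄
    ... | inj₁ refl | inj₁ refl | inj₁ refl | _ = no-three-common-hub d₁₂ d₁₃ d₂₃ d₁₄ d₂₄ d₃₄ A₁ A₂ A₃ A₄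
    ... | inj₂ refl | inj₂ refl | inj₂ refl | _ = no-three-common-hub d₁₂ d₁₃ d₂₃ d₁₄ d₂₄ d₃₄ A₁ A₂ A₃ A₄
    ... | inj₁ refl | inj₁ refl | inj₂ refl | inj₁ refl = no-three-common-hub d₁₂ d₁₄ d₂₄ d₁₃ d₂₃ (≢-sym d₃₄) A₁ A₂ A₄ A₃
    ... | inj₂ refl | inj₂ refl | inj₁ refl | inj₂ refl = no-three-common-hub d₁₂ d₁₄ d₂₄ d₁₃ d₂₃ (≢-sym d₃₄) A₁ A₂ A₄ A₃
    ... | inj₁ refl | inj₂ refl | inj₁ refl | inj₁ refl = no-three-common-hub d₁₃ d₁₄ d₃₄ d₁₂ (≢-sym d₂₃) (≢-sym d₂₄) A₁ A₃ A₄ A₂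
    ... | inj₂ refl | inj₁ refl | inj₂ refl | inj₂ refl = no-three-common-hub d₁₃ d₁₄ d₃₄ d₁₂ (≢-sym d₂₃) (≢-sym d₂₄) A₁ A₃ A₄ A₂
    ... | inj₂ refl | inj₁ refl | inj₁ refl | inj₁ refl =
      no-three-common-hub d₂₃ d₂₄ d₃₄ (≢-sym d₁₂) (≢-sym d₁₃) (≢-sym d₁₄) A₂ A₃ A₄ A₁
    ... | inj₁ refl | inj₂ refl | inj₂ refl | inj₂ refl =
      no-three-common-hub d₂₃ d₂₄ d₃₄ (≢-sym d₁₂) (≢-sym d₁₃) (≢-sym d₁₄) A₂ A₃ A₄ A₁
    ... | inj₁ refl | inj₁ refl | inj₂ refl | inj₂ refl = no-two-twin-pairs u y≢z hi d₁₂ d₁₃ d₁₄ d₂₃ d₂₄ d₃₄ A₁ A₂ A₃ A₄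
    ... | inj₁ refl | inj₂ refl | inj₁ refl | inj₂ refl = no-two-twin-pairs u y≢z hi d₁₃ d₁₂ d₁₄ (≢-sym d₂₃) d₃₄ d₂₄ A₁ A₃ A₂ A₄
    ... | inj₁ refl | inj₂ refl | inj₂ refl | inj₁ refl =
      no-two-twin-pairs u y≢z hi d₁₄ d₁₂ d₁₃ (≢-sym d₂₄) (≢-sym d₃₄) d₂₃ A₁ A₄ A₂ A₃
    ... | inj₂ refl | inj₁ refl | inj₁ refl | inj₂ refl =
      no-two-twin-pairs u y≢z hi d₂₃ (≢-sym d₁₂) d₂₄ (≢-sym d₁₃) d₃₄ d₁₄ A₂ A₃ A₁ A₄
    ... | inj₂ refl | inj₁ refl | inj₂ refl | inj₁ refl =
      no-two-twin-pairs u y≢z hi d₂₄ (≢-sym d₁₂) d₂₃ (≢-sym d₁₄) (≢-sym d₃₄) d₁₃ A₂ A₄ A₁ A₃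
    ... | inj₂ refl | inj₂ refl | inj₁ refl | inj₁ refl =
      no-two-twin-pairs u y≢z hi d₃₄ (≢-sym d₁₃) (≢-sym d₂₃) (≢-sym d₁₄) (≢-sym d₂₄) d₁₂ A₃ A₄ A₁ A₂

    deg2Nbr?⇐ : ∀ {x c} → x ~ c → deg c ≡ 2 → deg2Nbr? x c ≡ true
    deg2Nbr?⇐ {c = c} = ∧-does⇐ (deg c ≟ℕ 2)

    deg2Nbr?⇒ : ∀ {x c} → deg2Nbr? x c ≡ true → x ~ c × deg c ≡ 2
    deg2Nbr?⇒ {c = c} = ∧-does⇒ (deg c ≟ℕ 2)

    highNbr?⇐ : ∀ {x c} → x ~ c → deg c ≢ 2 → highNbr? x c ≡ true
    highNbr?⇐ {c = c} = ∧-not-does⇐ (deg c ≟ℕ 2)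

    highNbr?⇒ : ∀ {x c} → highNbr? x c ≡ true → x ~ c × deg c ≢ 2
    highNbr?⇒ {c = c} = ∧-not-does⇒ (deg c ≟ℕ 2)

    high-nbrs≤2 : ∀ {x y} → d₃ x ≤ 2 → x ~ y → deg y ≢ 2 →
                  ∃ λ z → HighNbrsIn x y z × (2 ≤ d₃ x → z ≢ y × x ~ z × deg z ≢ 2)
    high-nbrs≤2 {x} {y} d₃≤2 xy y≢2 with 2 ≤? d₃ x
    ... | no d₃≱2 = y , only-y , λ 2≤d₃ → ⊥-elim (d₃≱2 2≤d₃)
      where
      only-y : HighNbrsIn x y y
      only-y c xc c≢2 with count≤length⇒∈ (highNbr? x) ([] ∷ []) (highNbr?⇐ xy y≢2 ∷ []) (≤-pred (≰⇒> d₃≱2))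
                             (highNbr?⇐ xc c≢2)
      ... | here c≡y = inj₁ c≡y
    ... | yes 2≤d₃ with fresh (highNbr? x) [ y ] 2≤d₃
    ...   | z , xz? , z∉[y] = z , only-yz , λ _ → z≢y , highNbr?⇒ xz?
      where
      z≢y : z ≢ y
      z≢y z≡y = z∉[y] (here z≡y)
      only-yz : HighNbrsIn x y z
      only-yz c xc c≢2 with count≤length⇒∈ (highNbr? x) ((≢-sym z≢y ∷ []) ∷ [] ∷ []) (highNbr?⇐ xy y≢2 ∷ xz? ∷ [])
                              d₃≤2 (highNbr?⇐ xc c≢2)
      ... | here c≡y = inj₁ c≡y
      ... | there (here c≡z) = inj₂ c≡z

    at-most-two-deg2-nbrs : ∀ {x r w₁ w₂ h₁ h₂} → r ≢ x → adj G x r ≡ false → w₁ ≢ w₂ →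
                            Deg2Nbr x w₁ h₁ → Deg2Nbr x w₂ h₂ → ∀ c → x ~ c → deg c ≡ 2 → c ≡ w₁ ⊎ c ≡ w₂
    at-most-two-deg2-nbrs {x} {r} r≢x xr w₁≢w₂ D₁ D₂ c xc c2 with hub xc c2
    ... | _ , D = at-most-two-ends w₁≢w₂ (at-end D₁) (at-end D₂) (at-end D)
      where
      P = pathVia x r (≢-sym r≢x) xr
      at-end : ∀ {w h} → Deg2Nbr x w h → IsEnd (PathVia.A P) w
      at-end D = EndOfA⇒IsEnd (deg2-nbr-at-end xr (x~h D) (w~x D) (onlyNbrs D) P)

    single-deg2-nbr-case : ∀ {x y z w} → Deg2Nbr x w y → HighNbrsIn x y z → z ≢ y → x ~ z → deg z ≢ 2 →
                           (∀ c → x ~ c → deg c ≡ 2 → c ≡ w) → ⊥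
    single-deg2-nbr-case {x} {y} {z} {w} D high z≢y xz z≢2 only-w =
      SingleDeg2Nbr.impossible n≥6 (w~x D) (w~h D) (onlyNbrs D) xz N[x] (deg2≢ (deg-w≡2 D) z≢2) z≢y
      where
      N[x] : OnlyNbrs₃ x w y z
      N[x] c xc with deg c ≟ℕ 2
      ... | yes c2 = inj₁ (only-w c xc c2)
      ... | no c≢2 = inj₂ (high c xc c≢2)

    twin-deg2-nbrs-case : ∀ {x y z w₁ w₂} → Deg2Nbr x w₁ y → Deg2Nbr x w₂ y → w₁ ≢ w₂ → OnlyNbrs₄ x y z w₁ w₂ → ⊥
    twin-deg2-nbrs-case {x} {y} {z} {w₁} {w₂} D₁ D₂ w₁≢w₂ N[x] = no-TwinsConfig n≥6 record
      { s~s′ = x~h D₁ ; w₁~s = w~x D₁ ; w₁~s′ = w~h D₁ ; w₂~s = w~x D₂ ; w₂~s′ = w~h D₂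
      ; N[w₁] = onlyNbrs D₁ ; N[w₂] = onlyNbrs D₂ ; N[s] = N[x] ; N[s′] = N[y] } w₁≢w₂
      where
      N[y] : OnlyNbrs₄ y x z w₁ w₂
      N[y] c yc with c ≟ x
      ... | yes c≡x = inj₁ c≡x
      ... | no c≢x with adj G x c in xc
      ...   | false = ⊥-elim (twins-N[y]⊆N[x] w₁≢w₂ (x~h D₁) (w~x D₁) (w~h D₁) (onlyNbrs D₁)
                                (w~x D₂) (w~h D₂) (onlyNbrs D₂) c≢x xc yc)
      ...   | true with N[x] c xc
      ...     | inj₁ refl = ⊥-elim (~-irrefl yc refl)
      ...     | inj₂ rest = inj₂ rest

    two-deg2-nbrs-case : ∀ {x y z w₁ w₂ h₂} → Deg2Nbr x w₁ y → Deg2Nbr x w₂ h₂ → w₁ ≢ w₂ → HighNbrsIn x y z →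
                         (∀ c → x ~ c → deg c ≡ 2 → c ≡ w₁ ⊎ c ≡ w₂) → ⊥
    two-deg2-nbrs-case {x} {y} {z} {w₁} {w₂} {h₂} D₁ D₂ w₁≢w₂ high deg2-nbrs = by-hub (h₂ ≟ y)
      where
      N[x] : OnlyNbrs₄ x y z w₁ w₂
      N[x] c xc with deg c ≟ℕ 2
      ... | yes c2 = inj₂ (inj₂ (deg2-nbrs c xc c2))
      ... | no c≢2 with high c xc c≢2
      ...   | inj₁ c≡y = inj₁ c≡y
      ...   | inj₂ c≡z = inj₂ (inj₁ c≡z)
      by-hub : Dec (h₂ ≡ y) → ⊥
      by-hub (yes refl) = twin-deg2-nbrs-case D₁ D₂ w₁≢w₂ N[x]
      by-hub (no h₂≢y) with high h₂ (x~h D₂) (deg-h≢2 D₂)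
      ... | inj₁ h₂≡y = h₂≢y h₂≡y
      ... | inj₂ refl = TwoDeg2Nbrs.impossible n≥6 (w~x D₁) (w~h D₁) (onlyNbrs D₁) (w~x D₂) (w~h D₂) (onlyNbrs D₂)
                          (x~h D₂) N[x] (deg2≢ (deg-w≡2 D₁) (deg-h≢2 D₂)) h₂≢y

    universal-case : ∀ {x y z} → Universal x → d₃ x ≤ 2 → HighNbrsIn x y z → ⊥
    universal-case {x} {y} {z} universal d₃≤2 high = four-hubs (pick (deg2Nbr? x) 4 4≤d₂)
      where
      non-nbr-is-x : ∀ c → true ∧ not (adj G x c) ≡ true → c ∈ [ x ]
      non-nbr-is-x c nxc with c ≟ x
      ... | yes c≡x = here c≡x
      ... | no c≢x with adj G x c | universal c c≢x
      non-nbr-is-x c () | no _ | true | _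
      n≤1+deg : n ≤ suc (deg x)
      n≤1+deg = begin
        n                                                  ≡⟨ sym count-true ⟩
        count {n} (λ _ → true)                             ≡⟨ count-split (λ _ → true) (adj G x) ⟩
        deg x + count (λ c → true ∧ not (adj G x c))       ≤⟨ +-monoʳ-≤ (deg x) (count≤length _ [ x ] non-nbr-is-x) ⟩
        deg x + 1                                          ≡⟨ +-comm (deg x) 1 ⟩
        suc (deg x)                                        ∎
        where open ≤-Reasoning
      4≤d₂ : 4 ≤ d₂ x
      4≤d₂ = cancel-≤ (≤-pred (≤-trans n≥7 (subst (n ≤_) (cong suc (degree≡d₂+d₃ x)) n≤1+deg))) d₃≤2
      hub-of : ∀ {w} → deg2Nbr? x w ≡ true → ∃ (Deg2Nbr x w)
      hub-of xw = hub (proj₁ (deg2Nbr?⇒ xw)) (proj₂ (deg2Nbr?⇒ xw))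
      hub∈ : ∀ {w h} → Deg2Nbr x w h → h ≡ y ⊎ h ≡ z
      hub∈ D = high _ (x~h D) (deg-h≢2 D)
      four-hubs : (∃ λ L → length L ≡ 4 × Unique L × All (λ w → deg2Nbr? x w ≡ true) L) → ⊥
      four-hubs (a₁ ∷ a₂ ∷ a₃ ∷ a₄ ∷ [] , refl , (d₁₂ ∷ d₁₃ ∷ d₁₄ ∷ []) ∷ (d₂₃ ∷ d₂₄ ∷ []) ∷ (d₃₄ ∷ []) ∷ [] ∷ [] ,
                 xa₁ ∷ xa₂ ∷ xa₃ ∷ xa₄ ∷ [])
        with hub-of xa₁ | hub-of xa₂ | hub-of xa₃ | hub-of xa₄
      ... | h₁ , A₁ | h₂ , A₂ | h₃ , A₃ | h₄ , A₄ =
        two-hubs-impossible universal high d₁₂ d₁₃ d₁₄ d₂₃ d₂₄ d₃₄ A₁ A₂ A₃ A₄ (hub∈ A₁) (hub∈ A₂) (hub∈ A₃) (hub∈ A₄)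

    few-high-nbrs-impossible : ∀ {x} → deg x ≢ 2 → d₃ x ≤ 2 → ⊥
    few-high-nbrs-impossible {x} x≢2 d₃≤2
      with fresh (deg2Nbr? x) [] (cancel-≤ (subst (3 ≤_) (degree≡d₂+d₃ x) (degree≥3 x x≢2)) d₃≤2)
    ... | w₁ , xw₁ , _ with hub (proj₁ (deg2Nbr?⇒ xw₁)) (proj₂ (deg2Nbr?⇒ xw₁))
    ... | y , D₁ with high-nbrs≤2 d₃≤2 (x~h D₁) (deg-h≢2 D₁)
    ... | z , high , second-high with any? (λ r → ¬? (r ≟ x) ×-dec (adj G x r ≟ᵇ false))
    ... | no none = universal-case universal d₃≤2 high
      where
      universal : Universal x
      universal c c≢x with adj G x c in xc
      ... | true = refl
      ... | false = ⊥-elim (none (c , c≢x , xc))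
    ... | yes (r , r≢x , xr) with 2 ≤? d₂ x
    ...   | no 2≰d₂ = single-deg2-nbr-case D₁ high z≢y xz z≢2 only-w₁
      where
      d₂≤1 : d₂ x ≤ 1
      d₂≤1 = ≤-pred (≰⇒> 2≰d₂)
      only-w₁ : ∀ c → x ~ c → deg c ≡ 2 → c ≡ w₁
      only-w₁ c xc c2 with count≤length⇒∈ (deg2Nbr? x) ([] ∷ []) (xw₁ ∷ []) d₂≤1 (deg2Nbr?⇐ xc c2)
      ... | here c≡w₁ = c≡w₁
      z-high = second-high (cancel-≤ (subst (3 ≤_) (trans (degree≡d₂+d₃ x) (+-comm (d₂ x) (d₃ x))) (degree≥3 x x≢2)) d₂≤1)
      z≢y = proj₁ z-high
      xz = proj₁ (proj₂ z-high)
      z≢2 = proj₂ (proj₂ z-high)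
    ...   | yes 2≤d₂ with fresh (deg2Nbr? x) [ w₁ ] 2≤d₂
    ...     | w₂ , xw₂ , w₂∉[w₁] with hub (proj₁ (deg2Nbr?⇒ xw₂)) (proj₂ (deg2Nbr?⇒ xw₂))
    ...       | h₂ , D₂ =
      two-deg2-nbrs-case D₁ D₂ w₁≢w₂ high (at-most-two-deg2-nbrs r≢x xr w₁≢w₂ D₁ D₂)
      where
      w₁≢w₂ : w₁ ≢ w₂
      w₁≢w₂ w₁≡w₂ = w₂∉[w₁] (here (sym w₁≡w₂))

    high-nbrs≥3 : ∀ x → deg2? x ≡ false → 3 ≤ d₃ x
    high-nbrs≥3 x x≢2 with 3 ≤? d₃ x
    ... | yes 3≤d₃ = 3≤d₃
    ... | no 3≰d₃ = ⊥-elim (few-high-nbrs-impossible (λ x2 → clash (dec-true (deg x ≟ℕ 2) x2) x≢2) (≤-pred (≰⇒> 3≰d₃)))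

    deg2-high-nbrs : ∀ x → deg2? x ≡ true → 2 ≤ d₃ x
    deg2-high-nbrs x x2 = ≤-reflexive (trans (sym (does⇒ (deg x ≟ℕ 2) x2)) (trans (degree≡d₂+d₃ x) (cong (_+ d₃ x) d₂≡0)))
      where
      no-deg2-nbr : ∀ c → deg2Nbr? x c ≡ false
      no-deg2-nbr c with adj G x c in xc | deg2? c in c2
      ... | false | _ = refl
      ... | true | false = refl
      ... | true | true = ⊥-elim (no-adjacent-deg2 x c xc (does⇒ (deg x ≟ℕ 2) x2 , does⇒ (deg c ≟ℕ 2) c2))
      d₂≡0 : d₂ x ≡ 0
      d₂≡0 = count-false (deg2Nbr? x) no-deg2-nbr

theorem8 : (n : ℕ) → n ≥ 7 → (G : Graph n) → Connected G → MaximalNontraceable G →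
    (∀ v → ¬ (degree G v ≡ 1)) →
    (∀ u v → Adjacent G u v → ¬ (degree G u ≡ 2 × degree G v ≡ 2)) →
    (m : ℕ) → count (λ v → degree G v ≡ᵇ 2) ≡ m →
    2 * edges G ≥ 3 * n + m
theorem8 (suc k) n≥7 G connected mnt no-deg1 no-adjacent-deg2 _ refl =
  edge-bound (high-nbrs≥3 n≥7 connected no-deg1 no-adjacent-deg2)
             (deg2-high-nbrs n≥7 connected no-deg1 no-adjacent-deg2)
  where
  open Degree2Nbrs G
  open MaximalNontraceableGraph G mnt
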